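{- Let $v$ be a 2-additive normalized bi-capacity on $N$ with interaction transform $I$, and write $I_{i,j}=I_{\{i\},\{j\}}$, $I_{i,\emptyset}=I_{\{i\},\emptyset}$, $I_{\emptyset,i}=I_{\emptyset,\{i\}}$, $I_{ij,\emptyset}=I_{\{i,j\},\emptyset}$, $I_{\emptyset,ij}=I_{\emptyset,\{i,j\}}$. Then (i) $\sum_{i\in N}[I_{i,\emptyset}+I_{\emptyset,i}]=2$; (ii) $\sum_{i\in N}I_{\emptyset,i}=\frac12\sum_{i,j\in N,\,i\neq j}I_{i,j}+1$; (iii) $I_{\emptyset,\emptyset}=-\frac16\Big[\sum_{i,j\in N,\,i\ne j}I_{i,j}+\sum_{\{i,j\}\subseteq N}\big(I_{ij,\emptyset}+I_{\emptyset,ij}\big)\Big]$, where the last sum runs over 2-element subsets.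
   Context: $N=\{1,\ldots,n\}$. $\mathcal{Q}(N)=\{(A,B):A,B\subseteq N,A\cap B=\emptyset\}$ with $(A,B)\sqsubseteq(C,D)$ iff $A\subseteq C$, $B\supseteq D$; a bi-capacity is an isotone $v:\mathcal{Q}(N)\to\mathbb{R}$ with $v(\emptyset,\emptyset)=0$; it is normalized if $v(N,\emptyset)=1$ and $v(\emptyset,N)=-1$. M\"obius transform: $m(A,A')=\sum_{B\subseteq A}\sum_{A'\subseteq B'\subseteq N\setminus A}(-1)^{|A\setminus B|+|B'\setminus A'|}v(B,B')$; $v$ is 2-additive if $m(A,B)=0$ whenever $|B|<n-2$. Interaction transform: for $(S,T)\in\mathcal{Q}(N)$, $s=|S|,t=|T|$, $I_{S,T}=\sum_{K\subseteq N\setminus(S\cup T)}\frac{(n-s-t-|K|)!\,|K|!}{(n-s-t+1)!}\Delta_{S,T}v(K,N\setminus(K\cup S))$, where $\Delta_{S,T}v(K,L)=\sum_{S'\subseteq S}\sum_{T'\subseteq T}(-1)^{(s-|S'|)+(t-|T'|)}v(K\cup S',L\setminus T')$. -}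

module Defs where

open import Data.Nat using (ℕ; zero; suc; _∸_; _<_) renaming (_+_ to _+ℕ_; _*_ to _*ℕ_)
open import Data.Nat using (_!)
open import Data.Bool using (Bool; true; false; if_then_else_)
open import Data.Fin using (Fin)
open import Data.Fin.Subset using (Subset; inside; outside; ⊥; ⊤; ∁; _∩_; _∪_; _⊆_; ∣_∣)
open import Data.Fin.Subset.Properties using (_⊆?_)
open import Data.List using (List; []; _∷_; _++_; map; foldr)
import Data.List
import Data.Fin
import Data.Nat
open import Data.Product using (_×_; _,_)
open import Data.Vec using (Vec; []; _∷_)
open import Relation.Nullary using (¬_; does)
open import Relation.Binary.PropositionalEquality using (_≡_)
open import Algebra.Structures using (IsCommutativeRing)
open import Relation.Binary.Structures using (IsTotalOrder)

-- Ordered fields (the paper works over ℝ; we work over an arbitrary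
-- ordered field, of which ℝ is an instance).  Division is total with the
-- usual convention inv 0 = 0.

record OrderedField : Set₁ where
  infixl 6 _+_
  infixl 7 _*_
  infix  8 -_
  infix  4 _≤_
  field
    Carrier : Set
    _+_ _*_ : Carrier → Carrier → Carrier
    -_      : Carrier → Carrier
    0# 1#   : Carrier
    inv     : Carrier → Carrier
    _≤_     : Carrier → Carrier → Set
    isCommutativeRing : IsCommutativeRing _≡_ _+_ _*_ -_ 0# 1#
    0≢1     : ¬ (0# ≡ 1#)
    inv-0   : inv 0# ≡ 0#
    *-inv   : ∀ x → ¬ (x ≡ 0#) → x * inv x ≡ 1#
    isTotalOrder : IsTotalOrder _≡_ _≤_
    +-mono-≤ : ∀ x y z → x ≤ y → x + z ≤ y + z
    *-nonneg : ∀ x y → 0# ≤ x → 0# ≤ y → 0# ≤ x * y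

module Bicap (F : OrderedField) (n : ℕ) where
  open OrderedField F

  N : Subset n
  N = ⊤

  allSubsets : (m : ℕ) → List (Subset m)
  allSubsets zero    = [] ∷ []
  allSubsets (suc m) = map (inside ∷_) (allSubsets m) ++ map (outside ∷_) (allSubsets m)

  sumL : {A : Set} → List A → (A → Carrier) → Carrier
  sumL xs f = foldr (λ x acc → f x + acc) 0# xs

  sumN : (Fin n → Carrier) → Carrier
  sumN f = sumL (Data.List.allFin n) f

  sumSub : (Subset n → Bool) → (Subset n → Carrier) → Carrier
  sumSub P f = sumL (allSubsets n) (λ B → if P B then f B else 0#)

  _⊆ᵇ_ : Subset n → Subset n → Bool
  A ⊆ᵇ B = does (A ⊆? B)

  _∖_ : Subset n → Subset n → Subset n
  A ∖ B = A ∩ ∁ B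

  neg1^ : ℕ → Carrier
  neg1^ zero    = 1#
  neg1^ (suc k) = - neg1^ k

  fromℕ : ℕ → Carrier
  fromℕ zero    = 0#
  fromℕ (suc k) = 1# + fromℕ k

  Disjoint : Subset n → Subset n → Set
  Disjoint A B = A ∩ B ≡ ⊥

  -- a set function on pairs; only its values on Q(N) matter
  BiFun : Set
  BiFun = Subset n → Subset n → Carrier

  _⊑_ : (Subset n × Subset n) → (Subset n × Subset n) → Set
  (A , B) ⊑ (C , D) = A ⊆ C × D ⊆ B

  IsBiCapacity : BiFun → Set
  IsBiCapacity v =
    (∀ A B C D → Disjoint A B → Disjoint C D → (A , B) ⊑ (C , D) → v A B ≤ v C D)
    × v ⊥ ⊥ ≡ 0#

  IsNormalized : BiFun → Set
  IsNormalized v = v N ⊥ ≡ 1# × v ⊥ N ≡ - 1#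

  mobius : BiFun → Subset n → Subset n → Carrier
  mobius v A A' =
    sumSub (λ B → B ⊆ᵇ A) λ B →
      sumSub (λ B' → (A' ⊆ᵇ B') Data.Bool.∧ (B' ⊆ᵇ (N ∖ A))) λ B' →
        neg1^ (∣ A ∖ B ∣ +ℕ ∣ B' ∖ A' ∣) * v B B'

  Is2Additive : BiFun → Set
  Is2Additive v = ∀ A B → Disjoint A B → ∣ B ∣ < n ∸ 2 → mobius v A B ≡ 0#

  Δ : BiFun → Subset n → Subset n → Subset n → Subset n → Carrier
  Δ v S T K L =
    sumSub (λ S' → S' ⊆ᵇ S) λ S' →
      sumSub (λ T' → T' ⊆ᵇ T) λ T' →
        neg1^ ((∣ S ∣ ∸ ∣ S' ∣) +ℕ (∣ T ∣ ∸ ∣ T' ∣)) * v (K ∪ S') (L ∖ T')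

  interaction : BiFun → Subset n → Subset n → Carrier
  interaction v S T =
    sumSub (λ K → K ⊆ᵇ (N ∖ (S ∪ T))) λ K →
      (fromℕ (((r ∸ ∣ K ∣) !) *ℕ (∣ K ∣ !)) * inv (fromℕ ((suc r) !)))
        * Δ v S T K (N ∖ (K ∪ S))
    where r = n ∸ ∣ S ∣ ∸ ∣ T ∣

  sumNeq : (Fin n → Fin n → Carrier) → Carrier
  sumNeq f = sumN λ i → sumN λ j → if does (i Data.Fin.≟ j) then 0# else f i j

  sumPairs : (Subset n → Carrier) → Carrier
  sumPairs f = sumSub (λ S → does (∣ S ∣ Data.Nat.≟ 2)) f

-- By Möbius inversion, v(A,B) is the sum of m(C,D) u_{C,D}(A,B) over (C,D) ∈ Q(N), where
-- u_{C,D}(A,B) = [C ⊆ A][B ⊆ D] is a unanimity game, and the interaction transform is linear in v.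
-- For u_{C,D} every sum in the definition of I_{S,T} factors over the players: writing
-- E = N ∖ (C ∪ D) and Z = (C ∪ E) ∖ (S ∪ T), one gets I_{S,T}(u_{C,D}) = [S ⊆ C][T ⊆ E] / (|Z| + 1),
-- the weights (r−k)! k! / (r+1)! being Beta integrals.  So each index in the statement is
-- Σ m(C,D) f(|C|,|E|) for an explicit f.  2-additivity says m(C,D) = 0 unless |C| + |E| ≤ 2,
-- normalization gives Σ m(C,D) = 1 and Σ_{C ∪ E = ∅} m(C,D) = -1, and v(∅,∅) = 0 gives
-- Σ_{C = ∅} m(C,D) = 0; the three identities then reduce to identities between the values of
-- f in the six cases |C| + |E| ≤ 2.

module Submission where

open import Defs
open import Level using (0ℓ)
open import Algebra.Bundles using (CommutativeRing)
open import Algebra.Structures using (IsCommutativeRing)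
open import Algebra.Solver.Ring.AlmostCommutativeRing using (fromCommutativeRing; _-Raw-AlmostCommutative⟶_)
import Algebra.Solver.Ring
import Algebra.Properties.Ring
import Algebra.Properties.CommutativeSemigroup
import Algebra.Properties.CommutativeMonoid.Sum
import Algebra.Properties.Semiring.Sum
import Algebra.Properties.Semiring.Mult.TCOptimised
open import Data.Bool using (Bool; true; false; not; _∧_; _∨_; if_then_else_)
open import Data.Bool.Properties using (∧-zeroʳ)
open import Data.Empty using (⊥-elim)
open import Data.Fin using (Fin; zero; suc)
import Data.Fin as Fin
open import Data.Fin.Subset using (Subset; inside; outside; ⊤; ⊥; _∩_; _∪_; ∁; ∣_∣; ⁅_⁆)
open import Data.Fin.Subset.Properties using (_⊆?_; ⊥⊆; ⊆⊤; ∩-zeroˡ; ∩-zeroʳ; ∪-identityˡ; ∪-identityʳ; ∣⊥∣≡0; ∣⁅x⁆∣≡1)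
open import Data.Integer as ℤ using (ℤ; -[1+_]; _⊖_)
import Data.Integer.Properties as ℤ
open import Data.List using (List; []; _∷_; _++_; map; tabulate)
open import Data.Maybe using (Maybe; just; nothing)
open import Data.Nat using (ℕ; zero; suc; _∸_; _!; _<_; _<?_; _≟_; _≡ᵇ_; z≤n; s≤s; NonZero)
  renaming (_+_ to _+ℕ_; _*_ to _*ℕ_; _≤_ to _≤ℕ_)
open import Data.Nat.Combinatorics using (nCk+nC[k+1]≡[n+1]C[k+1]) renaming (_C_ to _choose_)
import Data.Nat.Properties as ℕ
open import Data.Nat.Solver using (module +-*-Solver)
open import Data.Product using (_×_; _,_)
open import Data.Sign as Sign using (Sign)
open import Data.Sum using (_⊎_; inj₁; inj₂)
open import Data.Vec using ([]; _∷_; lookup)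
open import Data.Vec.Properties using (lookup-zipWith; lookup-map; lookup-replicate; ∷-injective)
open import Relation.Binary.Structures using (IsTotalOrder)
open import Relation.Nullary using (¬_; Dec; does; yes; no)
open import Relation.Nullary.Decidable using (dec-true)
open import Relation.Binary.PropositionalEquality
open ≡-Reasoning

factorial-pascal : ∀ q a → (suc q) ! *ℕ a ! +ℕ q ! *ℕ (suc a) ! ≡ suc (suc (q +ℕ a)) *ℕ (q ! *ℕ a !)
factorial-pascal q a =
  solve 4 (λ q a x y → ((con 1 :+ q) :* x) :* y :+ x :* ((con 1 :+ a) :* y) := (con 2 :+ (q :+ a)) :* (x :* y)) refl q a (q !) (a !)
  where open +-*-Solver

-- How a player i enters the sum over K in I_{S,T}(u_{C,D}): a player of S ∪ T is never in K and
-- contributes a fixed factor, a player of D may or may not be in K, any other player must be in K.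
data Role : Set where
  fixed  : ℤ → Role
  free   : Role
  forced : Role

roleFactor : Role → Bool → ℤ
roleFactor (fixed g) true  = ℤ.+ 0
roleFactor (fixed g) false = g
roleFactor free      _     = ℤ.+ 1
roleFactor forced    true  = ℤ.+ 1
roleFactor forced    false = ℤ.+ 0

roleConstant : Role → ℤ
roleConstant (fixed g) = g
roleConstant free      = ℤ.+ 1
roleConstant forced    = ℤ.+ 1

isFree : Role → Bool
isFree free = true
isFree _    = false

isForced : Role → Bool
isForced forced = true
isForced _      = false

count : (m : ℕ) → (Fin m → Bool) → ℕ
count zero    p = 0
count (suc m) p = if p zero then suc (count m (λ i → p (suc i))) else count m (λ i → p (suc i))

count-cong : ∀ m (p q : Fin m → Bool) → (∀ i → p i ≡ q i) → count m p ≡ count m q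
count-cong zero    p q p≗q = refl
count-cong (suc m) p q p≗q with p zero | q zero | p≗q zero
... | true  | .true  | refl = cong suc (count-cong m _ _ (λ i → p≗q (suc i)))
... | false | .false | refl = count-cong m _ _ (λ i → p≗q (suc i))

count-lookup : ∀ {m} (A : Subset m) → count m (lookup A) ≡ ∣ A ∣
count-lookup []          = refl
count-lookup (true ∷ A)  = cong suc (count-lookup A)
count-lookup (false ∷ A) = count-lookup A

≮∸2⇒≤2 : ∀ y d → ¬ d < (y +ℕ d) ∸ 2 → y ≤ℕ 2
≮∸2⇒≤2 0                   d _ = z≤n
≮∸2⇒≤2 1                   d _ = s≤s z≤n
≮∸2⇒≤2 2                   d _ = s≤s (s≤s z≤n)
≮∸2⇒≤2 (suc (suc (suc y))) d d≮ = ⊥-elim (d≮ (s≤s (ℕ.m≤n+m d y)))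

module _ (F : OrderedField) where
  open OrderedField F
  open IsCommutativeRing isCommutativeRing
    using (+-identityˡ; +-identityʳ; *-identityˡ; *-identityʳ; zeroˡ; zeroʳ; -‿inverseʳ; +-comm; *-comm; +-assoc; *-assoc; distribˡ; distribʳ)
  open IsTotalOrder isTotalOrder using (total; antisym) renaming (refl to ≤-refl; trans to ≤-trans)

  commutativeRing : CommutativeRing 0ℓ 0ℓ
  commutativeRing = record { isCommutativeRing = isCommutativeRing }

  open CommutativeRing commutativeRing using (ring; semiring)
  open Algebra.Properties.Ring ring using (-‿distribˡ-*; -‿involutive; -0#≈0#; -‿+-comm; -1*x≈-x)
  open Algebra.Properties.CommutativeSemigroup (CommutativeRing.+-commutativeSemigroup commutativeRing)
    using () renaming (interchange to +-interchange)
  open Algebra.Properties.CommutativeSemigroup (CommutativeRing.*-commutativeSemigroup commutativeRing)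
    using () renaming (interchange to *-interchange)
  open Algebra.Properties.Semiring.Mult.TCOptimised semiring
    using (×-homo-+; ×1-homo-*; 1+×) renaming (_×_ to _×′_)

  ιℕ : ℕ → Carrier
  ιℕ k = k ×′ 1#

  ιℕ-suc : ∀ k → ιℕ (suc k) ≡ 1# + ιℕ k
  ιℕ-suc k = 1+× k 1#

  ι : ℤ → Carrier
  ι (ℤ.+ k)   = ιℕ k
  ι -[1+ k ] = - ιℕ (suc k)

  ι-⊖ : ∀ m n → ι (m ⊖ n) ≡ ιℕ m + - ιℕ n
  ι-⊖ zero    zero    = sym (trans (+-identityˡ _) -0#≈0#)
  ι-⊖ zero    (suc n) = sym (+-identityˡ _)
  ι-⊖ (suc m) zero    = sym (trans (cong (λ t → ιℕ (suc m) + t) -0#≈0#) (+-identityʳ _))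
  ι-⊖ (suc m) (suc n) = begin
    ι (suc m ⊖ suc n)                  ≡⟨ cong ι (ℤ.[1+m]⊖[1+n]≡m⊖n m n) ⟩
    ι (m ⊖ n)                          ≡⟨ ι-⊖ m n ⟩
    ιℕ m + - ιℕ n                      ≡⟨ sym (+-identityˡ _) ⟩
    0# + (ιℕ m + - ιℕ n)               ≡⟨ cong (_+ (ιℕ m + - ιℕ n)) (sym (-‿inverseʳ 1#)) ⟩
    (1# + - 1#) + (ιℕ m + - ιℕ n)      ≡⟨ +-interchange 1# (- 1#) (ιℕ m) (- ιℕ n) ⟩
    (1# + ιℕ m) + (- 1# + - ιℕ n)      ≡⟨ cong ((1# + ιℕ m) +_) (-‿+-comm 1# (ιℕ n)) ⟩
    (1# + ιℕ m) + - (1# + ιℕ n)        ≡⟨ sym (cong₂ (λ a b → a + - b) (ιℕ-suc m) (ιℕ-suc n)) ⟩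
    ιℕ (suc m) + - ιℕ (suc n)          ∎

  ι-+ : ∀ x y → ι (x ℤ.+ y) ≡ ι x + ι y
  ι-+ -[1+ m ] -[1+ n ] = begin
    - ιℕ (suc (suc (m +ℕ n)))       ≡⟨ cong (λ k → - ιℕ (suc k)) (sym (ℕ.+-suc m n)) ⟩
    - ιℕ (suc m +ℕ suc n)           ≡⟨ cong -_ (×-homo-+ 1# (suc m) (suc n)) ⟩
    - (ιℕ (suc m) + ιℕ (suc n))     ≡⟨ sym (-‿+-comm _ _) ⟩
    - ιℕ (suc m) + - ιℕ (suc n)     ∎
  ι-+ -[1+ m ] (ℤ.+ n) = trans (ι-⊖ n (suc m)) (+-comm _ _)
  ι-+ (ℤ.+ m) -[1+ n ] = ι-⊖ m (suc n)
  ι-+ (ℤ.+ m) (ℤ.+ n) = ×-homo-+ 1# m n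

  ιˢ : Sign → Carrier
  ιˢ Sign.+ = 1#
  ιˢ Sign.- = - 1#

  ι-◃ : ∀ s k → ι (s ℤ.◃ k) ≡ ιˢ s * ιℕ k
  ι-◃ s       zero    = sym (zeroʳ _)
  ι-◃ Sign.- (suc k) = trans (cong -_ (sym (*-identityˡ _))) (-‿distribˡ-* _ _)
  ι-◃ Sign.+ (suc k) = sym (*-identityˡ _)

  ι-sign-abs : ∀ x → ι x ≡ ιˢ (ℤ.sign x) * ιℕ ℤ.∣ x ∣
  ι-sign-abs x = trans (cong ι (sym (ℤ.◃-inverse x))) (ι-◃ (ℤ.sign x) ℤ.∣ x ∣)

  ιˢ-* : ∀ s t → ιˢ (s Sign.* t) ≡ ιˢ s * ιˢ t
  ιˢ-* Sign.- Sign.- = sym (trans (sym (-‿distribˡ-* _ _)) (trans (cong -_ (*-identityˡ (- 1#))) (-‿involutive 1#)))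
  ιˢ-* Sign.- Sign.+ = sym (*-identityʳ _)
  ιˢ-* Sign.+ Sign.- = sym (*-identityˡ _)
  ιˢ-* Sign.+ Sign.+ = sym (*-identityʳ _)

  ι-* : ∀ x y → ι (x ℤ.* y) ≡ ι x * ι y
  ι-* x y = begin
    ι ((ℤ.sign x Sign.* ℤ.sign y) ℤ.◃ (ℤ.∣ x ∣ *ℕ ℤ.∣ y ∣))   ≡⟨ ι-◃ (ℤ.sign x Sign.* ℤ.sign y) (ℤ.∣ x ∣ *ℕ ℤ.∣ y ∣) ⟩
    ιˢ (ℤ.sign x Sign.* ℤ.sign y) * ιℕ (ℤ.∣ x ∣ *ℕ ℤ.∣ y ∣)  ≡⟨ cong₂ _*_ (ιˢ-* (ℤ.sign x) (ℤ.sign y)) (×1-homo-* ℤ.∣ x ∣ ℤ.∣ y ∣) ⟩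
    (ιˢ (ℤ.sign x) * ιˢ (ℤ.sign y)) * (ιℕ ℤ.∣ x ∣ * ιℕ ℤ.∣ y ∣) ≡⟨ *-interchange _ _ _ _ ⟩
    (ιˢ (ℤ.sign x) * ιℕ ℤ.∣ x ∣) * (ιˢ (ℤ.sign y) * ιℕ ℤ.∣ y ∣) ≡⟨ sym (cong₂ _*_ (ι-sign-abs x) (ι-sign-abs y)) ⟩
    ι x * ι y                                                  ∎

  ι-neg : ∀ x → ι (ℤ.- x) ≡ - ι x
  ι-neg (ℤ.+ zero)  = sym -0#≈0#
  ι-neg (ℤ.+ suc k) = refl
  ι-neg -[1+ k ]  = sym (-‿involutive _)

  ι-homomorphism : CommutativeRing.rawRing ℤ.+-*-commutativeRing -Raw-AlmostCommutative⟶ fromCommutativeRing commutativeRing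
  ι-homomorphism = record
    { ⟦_⟧ = ι ; +-homo = ι-+ ; *-homo = ι-* ; -‿homo = ι-neg ; 0-homo = refl ; 1-homo = refl }

  coefficient≟ : (a b : ℤ) → Maybe (ι a ≡ ι b)
  coefficient≟ a b with a ℤ.≟ b
  ... | yes refl = just refl
  ... | no _     = nothing

  open Algebra.Solver.Ring (CommutativeRing.rawRing ℤ.+-*-commutativeRing) (fromCommutativeRing commutativeRing) ι-homomorphism coefficient≟
    using (_:=_; _:+_; _:*_; :-_; con; solve)

  open Algebra.Properties.CommutativeMonoid.Sum (CommutativeRing.+-commutativeMonoid commutativeRing)
    using (sum; sum-cong-≗) renaming (∑-distrib-+ to sum-distrib-+)
  open Algebra.Properties.Semiring.Sum semiring using (*-distribˡ-sum; *-distribʳ-sum)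

  ∑ : (m : ℕ) → (Subset m → Carrier) → Carrier
  ∑ zero    f = f []
  ∑ (suc m) f = ∑ m (λ X → f (inside ∷ X)) + ∑ m (λ X → f (outside ∷ X))

  ∑-cong : ∀ m {f g : Subset m → Carrier} → (∀ X → f X ≡ g X) → ∑ m f ≡ ∑ m g
  ∑-cong zero    f≗g = f≗g []
  ∑-cong (suc m) f≗g = cong₂ _+_ (∑-cong m (λ X → f≗g (inside ∷ X))) (∑-cong m (λ X → f≗g (outside ∷ X)))

  ∑-+ : ∀ m (f g : Subset m → Carrier) → ∑ m (λ X → f X + g X) ≡ ∑ m f + ∑ m g
  ∑-+ zero    f g = refl
  ∑-+ (suc m) f g = trans (cong₂ _+_ (∑-+ m _ _) (∑-+ m _ _)) (+-interchange _ _ _ _)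

  ∑-*ˡ : ∀ m c (f : Subset m → Carrier) → ∑ m (λ X → c * f X) ≡ c * ∑ m f
  ∑-*ˡ zero    c f = refl
  ∑-*ˡ (suc m) c f = trans (cong₂ _+_ (∑-*ˡ m c _) (∑-*ˡ m c _)) (sym (distribˡ c _ _))

  ∑-*ʳ : ∀ m c (f : Subset m → Carrier) → ∑ m (λ X → f X * c) ≡ ∑ m f * c
  ∑-*ʳ m c f = trans (∑-cong m (λ X → *-comm (f X) c)) (trans (∑-*ˡ m c f) (*-comm c _))

  ∑-0 : ∀ m → ∑ m (λ _ → 0#) ≡ 0#
  ∑-0 zero    = refl
  ∑-0 (suc m) = trans (cong₂ _+_ (∑-0 m) (∑-0 m)) (+-identityʳ 0#)

  ∑-comm : ∀ m k (f : Subset m → Subset k → Carrier) →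
           ∑ m (λ X → ∑ k (λ Y → f X Y)) ≡ ∑ k (λ Y → ∑ m (λ X → f X Y))
  ∑-comm zero    k f = refl
  ∑-comm (suc m) k f = trans (cong₂ _+_ (∑-comm m k _) (∑-comm m k _)) (sym (∑-+ k _ _))

  ∏ : (m : ℕ) → (Fin m → Carrier) → Carrier
  ∏ zero    f = 1#
  ∏ (suc m) f = f zero * ∏ m (λ i → f (suc i))

  ∏-cong : ∀ m {f g : Fin m → Carrier} → (∀ i → f i ≡ g i) → ∏ m f ≡ ∏ m g
  ∏-cong zero    f≗g = refl
  ∏-cong (suc m) f≗g = cong₂ _*_ (f≗g zero) (∏-cong m (λ i → f≗g (suc i)))

  ∏-* : ∀ m (f g : Fin m → Carrier) → ∏ m f * ∏ m g ≡ ∏ m (λ i → f i * g i)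
  ∏-* zero    f g = *-identityʳ 1#
  ∏-* (suc m) f g = trans (*-interchange _ _ _ _) (cong ((f zero * g zero) *_) (∏-* m _ _))

  ∑-∏ : ∀ m (f : Fin m → Bool → Carrier) →
        ∑ m (λ X → ∏ m (λ i → f i (lookup X i))) ≡ ∏ m (λ i → f i true + f i false)
  ∑-∏ zero    f = refl
  ∑-∏ (suc m) f = begin
    ∑ m (λ X → f zero true * P X) + ∑ m (λ X → f zero false * P X)
      ≡⟨ cong₂ _+_ (∑-*ˡ m _ _) (∑-*ˡ m _ _) ⟩
    f zero true * ∑ m P + f zero false * ∑ m P
      ≡⟨ sym (distribʳ _ _ _) ⟩
    (f zero true + f zero false) * ∑ m P
      ≡⟨ cong ((f zero true + f zero false) *_) (∑-∏ m (λ i → f (suc i))) ⟩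
    (f zero true + f zero false) * ∏ m (λ i → f (suc i) true + f (suc i) false) ∎
    where P = λ (X : Subset m) → ∏ m (λ i → f (suc i) (lookup X i))

  ⟦_⟧ : Bool → Carrier
  ⟦ b ⟧ = if b then 1# else 0#

  if-then-0≡⟦⟧* : ∀ b x → (if b then x else 0#) ≡ ⟦ b ⟧ * x
  if-then-0≡⟦⟧* true  x = sym (*-identityˡ x)
  if-then-0≡⟦⟧* false x = sym (zeroˡ x)

  module _ (n : ℕ) where
    open Bicap F n using (sumL; allSubsets; sumSub; sumN)

    sumL-++ : {A : Set} (xs ys : List A) (f : A → Carrier) → sumL (xs ++ ys) f ≡ sumL xs f + sumL ys f
    sumL-++ []       ys f = sym (+-identityˡ _)
    sumL-++ (x ∷ xs) ys f = trans (cong (f x +_) (sumL-++ xs ys f)) (sym (+-assoc _ _ _))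

    sumL-map : {A B : Set} (g : A → B) (xs : List A) (f : B → Carrier) → sumL (map g xs) f ≡ sumL xs (λ x → f (g x))
    sumL-map g []       f = refl
    sumL-map g (x ∷ xs) f = cong (f (g x) +_) (sumL-map g xs f)

    sumL-allSubsets : ∀ m f → sumL (allSubsets m) f ≡ ∑ m f
    sumL-allSubsets zero    f = +-identityʳ _
    sumL-allSubsets (suc m) f = begin
      sumL (map (inside ∷_) (allSubsets m) ++ map (outside ∷_) (allSubsets m)) f
        ≡⟨ sumL-++ (map (inside ∷_) (allSubsets m)) _ f ⟩
      sumL (map (inside ∷_) (allSubsets m)) f + sumL (map (outside ∷_) (allSubsets m)) f
        ≡⟨ cong₂ _+_ (sumL-map (inside ∷_) (allSubsets m) f) (sumL-map (outside ∷_) (allSubsets m) f) ⟩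
      sumL (allSubsets m) (λ X → f (inside ∷ X)) + sumL (allSubsets m) (λ X → f (outside ∷ X))
        ≡⟨ cong₂ _+_ (sumL-allSubsets m _) (sumL-allSubsets m _) ⟩
      ∑ (suc m) f ∎

    sumSub≡∑ : ∀ P f → sumSub P f ≡ ∑ n (λ X → ⟦ P X ⟧ * f X)
    sumSub≡∑ P f = trans (sumL-allSubsets n _) (∑-cong n (λ X → if-then-0≡⟦⟧* (P X) (f X)))

    sumL-tabulate : ∀ {A : Set} m (g : Fin m → A) (f : A → Carrier) → sumL (tabulate g) f ≡ sum (λ i → f (g i))
    sumL-tabulate zero    g f = refl
    sumL-tabulate (suc m) g f = cong (f (g zero) +_) (sumL-tabulate m (λ i → g (suc i)) f)

    sumN≡sum : ∀ f → sumN f ≡ sum f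
    sumN≡sum f = sumL-tabulate n (λ i → i) f

  ∑² : (m : ℕ) → (Subset m → Subset m → Carrier) → Carrier
  ∑² m f = ∑ m (λ X → ∑ m (λ Y → f X Y))

  ∑²-cong : ∀ m {f g : Subset m → Subset m → Carrier} → (∀ X Y → f X Y ≡ g X Y) → ∑² m f ≡ ∑² m g
  ∑²-cong m f≗g = ∑-cong m (λ X → ∑-cong m (λ Y → f≗g X Y))

  ∑²-+ : ∀ m (f g : Subset m → Subset m → Carrier) → ∑² m (λ X Y → f X Y + g X Y) ≡ ∑² m f + ∑² m g
  ∑²-+ m f g = trans (∑-cong m (λ X → ∑-+ m _ _)) (∑-+ m _ _)

  ∑²-*ˡ : ∀ m c (f : Subset m → Subset m → Carrier) → ∑² m (λ X Y → c * f X Y) ≡ c * ∑² m f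
  ∑²-*ˡ m c f = trans (∑-cong m (λ X → ∑-*ˡ m c _)) (∑-*ˡ m c _)

  ∑²-*ʳ : ∀ m c (f : Subset m → Subset m → Carrier) → ∑² m (λ X Y → f X Y * c) ≡ ∑² m f * c
  ∑²-*ʳ m c f = trans (∑-cong m (λ X → ∑-*ʳ m c _)) (∑-*ʳ m c _)

  ∑²-0 : ∀ m → ∑² m (λ _ _ → 0#) ≡ 0#
  ∑²-0 m = trans (∑-cong m (λ _ → ∑-0 m)) (∑-0 m)

  ∑²-comm : ∀ m (f : Subset m → Subset m → Subset m → Subset m → Carrier) →
            ∑² m (λ C D → ∑² m (λ X Y → f C D X Y)) ≡ ∑² m (λ X Y → ∑² m (λ C D → f C D X Y))
  ∑²-comm m f = begin
    ∑ m (λ C → ∑ m (λ D → ∑ m (λ X → ∑ m (λ Y → f C D X Y)))) ≡⟨ ∑-cong m (λ C → ∑-comm m m _) ⟩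
    ∑ m (λ C → ∑ m (λ X → ∑ m (λ D → ∑ m (λ Y → f C D X Y)))) ≡⟨ ∑-comm m m _ ⟩
    ∑ m (λ X → ∑ m (λ C → ∑ m (λ D → ∑ m (λ Y → f C D X Y)))) ≡⟨ ∑-cong m (λ X → ∑-cong m (λ C → ∑-comm m m _)) ⟩
    ∑ m (λ X → ∑ m (λ C → ∑ m (λ Y → ∑ m (λ D → f C D X Y)))) ≡⟨ ∑-cong m (λ X → ∑-comm m m _) ⟩
    ∑ m (λ X → ∑ m (λ Y → ∑ m (λ C → ∑ m (λ D → f C D X Y)))) ∎

  sum-∑² : ∀ k m (f : Fin k → Subset m → Subset m → Carrier) →
           sum (λ i → ∑² m (f i)) ≡ ∑² m (λ C D → sum (λ i → f i C D))
  sum-∑² zero    m f = sym (∑²-0 m)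
  sum-∑² (suc k) m f = begin
    ∑² m (f zero) + sum (λ i → ∑² m (f (suc i)))             ≡⟨ cong (∑² m (f zero) +_) (sum-∑² k m (λ i → f (suc i))) ⟩
    ∑² m (f zero) + ∑² m (λ C D → sum (λ i → f (suc i) C D)) ≡⟨ sym (∑²-+ m _ _) ⟩
    ∑² m (λ C D → sum (λ i → f i C D))                       ∎

  ⟦⟧*-cong : ∀ b {x y} → (b ≡ true → x ≡ y) → ⟦ b ⟧ * x ≡ ⟦ b ⟧ * y
  ⟦⟧*-cong true  x≡y = cong (1# *_) (x≡y refl)
  ⟦⟧*-cong false _   = trans (zeroˡ _) (sym (zeroˡ _))

  ⟦⟧*⟦⟧*-cong : ∀ a b {x y} → (a ≡ true → b ≡ true → x ≡ y) → (⟦ a ⟧ * ⟦ b ⟧) * x ≡ (⟦ a ⟧ * ⟦ b ⟧) * y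
  ⟦⟧*⟦⟧*-cong a b x≡y =
    trans (*-assoc _ _ _) (trans (⟦⟧*-cong a (λ a≡true → ⟦⟧*-cong b (x≡y a≡true))) (sym (*-assoc _ _ _)))

  lookup-∪ : ∀ {m} (A B : Subset m) i → lookup (A ∪ B) i ≡ (lookup A i ∨ lookup B i)
  lookup-∪ A B i = lookup-zipWith _∨_ i A B

  lookup-∩ : ∀ {m} (A B : Subset m) i → lookup (A ∩ B) i ≡ (lookup A i ∧ lookup B i)
  lookup-∩ A B i = lookup-zipWith _∧_ i A B

  lookup-∖ : ∀ {m} (A B : Subset m) i → lookup (A ∩ ∁ B) i ≡ (lookup A i ∧ not (lookup B i))
  lookup-∖ A B i = trans (lookup-∩ A (∁ B) i) (cong (lookup A i ∧_) (lookup-map i not B))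

  lookup-⊤ : ∀ {m} (i : Fin m) → lookup (⊤ {m}) i ≡ true
  lookup-⊤ i = lookup-replicate i true

  lookup-⊥ : ∀ {m} (i : Fin m) → lookup (⊥ {m}) i ≡ false
  lookup-⊥ i = lookup-replicate i false

  _⇒ᵇ_ : Bool → Bool → Bool
  a ⇒ᵇ b = not a ∨ b

  -- Indicator and sign factors are computed coordinatewise in ℤ, where each coordinate
  -- identity holds by refl, and then carried to the field by ι.
  𝟙 : Bool → ℤ
  𝟙 true  = ℤ.+ 1
  𝟙 false = ℤ.+ 0

  sgn : Bool → ℤ
  sgn true  = -[1+ 0 ]
  sgn false = ℤ.+ 1

  ∏ℤ : (m : ℕ) → (Fin m → ℤ) → Carrier
  ∏ℤ m f = ∏ m (λ i → ι (f i))

  ∏ℤ-cong : ∀ m {f g : Fin m → ℤ} → (∀ i → f i ≡ g i) → ∏ℤ m f ≡ ∏ℤ m g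
  ∏ℤ-cong m f≗g = ∏-cong m (λ i → cong ι (f≗g i))

  ∏ℤ-* : ∀ m (f g : Fin m → ℤ) → ∏ℤ m f * ∏ℤ m g ≡ ∏ℤ m (λ i → f i ℤ.* g i)
  ∏ℤ-* m f g = trans (∏-* m _ _) (∏-cong m (λ i → sym (ι-* (f i) (g i))))

  ⟦⊆?⟧≡∏ : ∀ {m} (A B : Subset m) → ⟦ does (A ⊆? B) ⟧ ≡ ∏ℤ m (λ i → 𝟙 (lookup A i ⇒ᵇ lookup B i))
  ⟦⊆?⟧≡∏ []          []          = refl
  ⟦⊆?⟧≡∏ (false ∷ A) (_ ∷ B)     = trans (⟦⊆?⟧≡∏ A B) (sym (*-identityˡ _))
  ⟦⊆?⟧≡∏ (true ∷ A)  (false ∷ B) = sym (zeroˡ _)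
  ⟦⊆?⟧≡∏ (true ∷ A)  (true ∷ B)  = trans (⟦⊆?⟧≡∏ A B) (sym (*-identityˡ _))

  neg1^ℤ : ℕ → ℤ
  neg1^ℤ zero    = ℤ.+ 1
  neg1^ℤ (suc k) = ℤ.- neg1^ℤ k

  neg1^ℤ-+ : ∀ a b → neg1^ℤ (a +ℕ b) ≡ neg1^ℤ a ℤ.* neg1^ℤ b
  neg1^ℤ-+ zero    b = sym (ℤ.*-identityˡ (neg1^ℤ b))
  neg1^ℤ-+ (suc a) b = trans (cong ℤ.-_ (neg1^ℤ-+ a b)) (ℤ.neg-distribˡ-* (neg1^ℤ a) (neg1^ℤ b))

  neg1^ℤ∣∣≡∏ : ∀ {m} (A : Subset m) → ι (neg1^ℤ ∣ A ∣) ≡ ∏ℤ m (λ i → sgn (lookup A i))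
  neg1^ℤ∣∣≡∏ []          = refl
  neg1^ℤ∣∣≡∏ (true ∷ A)  = begin
    ι (ℤ.- neg1^ℤ ∣ A ∣)                 ≡⟨ cong ι (sym (ℤ.-1*i≡-i (neg1^ℤ ∣ A ∣))) ⟩
    ι (-[1+ 0 ] ℤ.* neg1^ℤ ∣ A ∣)        ≡⟨ ι-* -[1+ 0 ] (neg1^ℤ ∣ A ∣) ⟩
    ι -[1+ 0 ] * ι (neg1^ℤ ∣ A ∣)        ≡⟨ cong (ι -[1+ 0 ] *_) (neg1^ℤ∣∣≡∏ A) ⟩
    ι -[1+ 0 ] * ∏ℤ _ (λ i → sgn (lookup A i)) ∎
  neg1^ℤ∣∣≡∏ (false ∷ A) = trans (neg1^ℤ∣∣≡∏ A) (sym (*-identityˡ _))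

  module _ (n : ℕ) where
    open Bicap F n using (neg1^; fromℕ)

    neg1^≡ι : ∀ k → neg1^ k ≡ ι (neg1^ℤ k)
    neg1^≡ι zero    = refl
    neg1^≡ι (suc k) = trans (cong -_ (neg1^≡ι k)) (sym (ι-neg (neg1^ℤ k)))

    fromℕ≡ιℕ : ∀ k → fromℕ k ≡ ιℕ k
    fromℕ≡ιℕ zero    = refl
    fromℕ≡ιℕ (suc k) = trans (cong (1# +_) (fromℕ≡ιℕ k)) (sym (ιℕ-suc k))

  ι-+₄ : ∀ a b c d → ι (a ℤ.+ b ℤ.+ (c ℤ.+ d)) ≡ (ι a + ι b) + (ι c + ι d)
  ι-+₄ a b c d = trans (ι-+ (a ℤ.+ b) (c ℤ.+ d)) (cong₂ _+_ (ι-+ a b) (ι-+ c d))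

  ∑²-∏ : ∀ m (f : Fin m → Bool → Bool → ℤ) →
         ∑² m (λ C D → ∏ℤ m (λ i → f i (lookup C i) (lookup D i)))
         ≡ ∏ m (λ i → ι (f i true true ℤ.+ f i true false ℤ.+ (f i false true ℤ.+ f i false false)))
  ∑²-∏ m f = begin
    ∑² m (λ C D → ∏ℤ m (λ i → f i (lookup C i) (lookup D i)))
      ≡⟨ ∑-cong m (λ C → ∑-∏ m (λ i d → ι (f i (lookup C i) d))) ⟩
    ∑ m (λ C → ∏ m (λ i → ι (f i (lookup C i) true) + ι (f i (lookup C i) false)))
      ≡⟨ ∑-∏ m (λ i c → ι (f i c true) + ι (f i c false)) ⟩
    ∏ m (λ i → (ι (f i true true) + ι (f i true false)) + (ι (f i false true) + ι (f i false false)))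
      ≡⟨ ∏-cong m (λ i → sym (ι-+₄ (f i true true) (f i true false) (f i false true) (f i false false))) ⟩
    ∏ m (λ i → ι (f i true true ℤ.+ f i true false ℤ.+ (f i false true ℤ.+ f i false false))) ∎

  -- Möbius inversion

  disjoint? : ∀ {m} → Subset m → Subset m → Bool
  disjoint? C D = does ((C ∩ D) ⊆? ⊥)

  unanimity : ∀ {m} → Subset m → Subset m → Subset m → Subset m → Carrier
  unanimity C D A B = ⟦ does (C ⊆? A) ⟧ * ⟦ does (B ⊆? D) ⟧

  _⇔ᵇ_ : Bool → Bool → Bool
  a ⇔ᵇ x = (a ∧ x) ∨ (not a ∧ not x)

  ∑-δ : ∀ m (A : Subset m) (f : Subset m → Carrier) →
        ∑ m (λ X → ∏ℤ m (λ i → 𝟙 (lookup A i ⇔ᵇ lookup X i)) * f X) ≡ f A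
  ∑-δ zero    [] f = *-identityˡ _
  ∑-δ (suc m) (inside ∷ A) f = begin
    ∑ m (λ X → (1# * P X) * f (inside ∷ X)) + ∑ m (λ X → (0# * P X) * f (outside ∷ X))
      ≡⟨ cong₂ _+_ (∑-cong m (λ X → cong (_* f (inside ∷ X)) (*-identityˡ _)))
                   (∑-cong m (λ X → trans (cong (_* f (outside ∷ X)) (zeroˡ _)) (zeroˡ _))) ⟩
    ∑ m (λ X → P X * f (inside ∷ X)) + ∑ m (λ _ → 0#) ≡⟨ cong₂ _+_ (∑-δ m A _) (∑-0 m) ⟩
    f (inside ∷ A) + 0#                                 ≡⟨ +-identityʳ _ ⟩
    f (inside ∷ A)                                      ∎
    where P = λ (X : Subset m) → ∏ℤ m (λ i → 𝟙 (lookup A i ⇔ᵇ lookup X i))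
  ∑-δ (suc m) (outside ∷ A) f = begin
    ∑ m (λ X → (0# * P X) * f (inside ∷ X)) + ∑ m (λ X → (1# * P X) * f (outside ∷ X))
      ≡⟨ cong₂ _+_ (∑-cong m (λ X → trans (cong (_* f (inside ∷ X)) (zeroˡ _)) (zeroˡ _)))
                   (∑-cong m (λ X → cong (_* f (outside ∷ X)) (*-identityˡ _))) ⟩
    ∑ m (λ _ → 0#) + ∑ m (λ X → P X * f (outside ∷ X)) ≡⟨ cong₂ _+_ (∑-0 m) (∑-δ m A _) ⟩
    0# + f (outside ∷ A)                                ≡⟨ +-identityˡ _ ⟩
    f (outside ∷ A)                                     ∎
    where P = λ (X : Subset m) → ∏ℤ m (λ i → 𝟙 (lookup A i ⇔ᵇ lookup X i))

  ∑²-δ : ∀ m (A B : Subset m) (f : Subset m → Subset m → Carrier) →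
         ∑² m (λ X Y → ∏ℤ m (λ i → 𝟙 (lookup A i ⇔ᵇ lookup X i) ℤ.* 𝟙 (lookup B i ⇔ᵇ lookup Y i)) * f X Y) ≡ f A B
  ∑²-δ m A B f = begin
    ∑² m (λ X Y → ∏ℤ m (λ i → 𝟙 (lookup A i ⇔ᵇ lookup X i) ℤ.* 𝟙 (lookup B i ⇔ᵇ lookup Y i)) * f X Y)
      ≡⟨ ∑²-cong m (λ X Y → trans (cong (_* f X Y) (sym (∏ℤ-* m (λ i → 𝟙 (lookup A i ⇔ᵇ lookup X i)) (λ i → 𝟙 (lookup B i ⇔ᵇ lookup Y i))))) (*-assoc _ _ _)) ⟩
    ∑ m (λ X → ∑ m (λ Y → δ A X * (δ B Y * f X Y)))  ≡⟨ ∑-cong m (λ X → ∑-*ˡ m _ _) ⟩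
    ∑ m (λ X → δ A X * ∑ m (λ Y → δ B Y * f X Y))    ≡⟨ ∑-cong m (λ X → cong (δ A X *_) (∑-δ m B (f X))) ⟩
    ∑ m (λ X → δ A X * f X B)                        ≡⟨ ∑-δ m A (λ X → f X B) ⟩
    f A B                                            ∎
    where δ = λ (A X : Subset m) → ∏ℤ m (λ i → 𝟙 (lookup A i ⇔ᵇ lookup X i))

  mobiusFactor : Bool → Bool → Bool → Bool → ℤ
  mobiusFactor c d x y =
    𝟙 (x ⇒ᵇ c) ℤ.* 𝟙 (d ⇒ᵇ y) ℤ.* 𝟙 (y ⇒ᵇ (true ∧ not c)) ℤ.* sgn (c ∧ not x) ℤ.* sgn (y ∧ not d)

  module _ (n : ℕ) (v : Subset n → Subset n → Carrier) where
    open Bicap F n using (mobius; neg1^)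

    mobius-summand≡∏ : ∀ C D X Y →
      ⟦ does (X ⊆? C) ⟧ * (⟦ does (D ⊆? Y) ∧ does (Y ⊆? (⊤ ∩ ∁ C)) ⟧ * (neg1^ (∣ C ∩ ∁ X ∣ +ℕ ∣ Y ∩ ∁ D ∣) * v X Y))
      ≡ ∏ℤ n (λ i → mobiusFactor (lookup C i) (lookup D i) (lookup X i) (lookup Y i)) * v X Y
    mobius-summand≡∏ C D X Y = begin
      ⟦ does (X ⊆? C) ⟧ * (⟦ does (D ⊆? Y) ∧ does (Y ⊆? (⊤ ∩ ∁ C)) ⟧ * (neg1^ (∣ C ∩ ∁ X ∣ +ℕ ∣ Y ∩ ∁ D ∣) * v X Y))
        ≡⟨ cong₂ (λ a b → ⟦ does (X ⊆? C) ⟧ * (a * (b * v X Y))) (⟦∧⟧ (does (D ⊆? Y)) _) sign≡ ⟩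
      ⟦ does (X ⊆? C) ⟧ * ((⟦ does (D ⊆? Y) ⟧ * ⟦ does (Y ⊆? (⊤ ∩ ∁ C)) ⟧)
        * ((ι (neg1^ℤ ∣ C ∩ ∁ X ∣) * ι (neg1^ℤ ∣ Y ∩ ∁ D ∣)) * v X Y))
        ≡⟨ solve 6 (λ a b c d e v → (a :* ((b :* c) :* ((d :* e) :* v))) := (((((a :* b) :* c) :* d) :* e) :* v)) refl _ _ _ _ _ _ ⟩
      ((((⟦ does (X ⊆? C) ⟧ * ⟦ does (D ⊆? Y) ⟧) * ⟦ does (Y ⊆? (⊤ ∩ ∁ C)) ⟧) * ι (neg1^ℤ ∣ C ∩ ∁ X ∣)) * ι (neg1^ℤ ∣ Y ∩ ∁ D ∣)) * v X Y
        ≡⟨ cong (_* v X Y) (cong₂ _*_ (cong₂ _*_ (cong₂ _*_ (cong₂ _*_ (⟦⊆?⟧≡∏ X C) (⟦⊆?⟧≡∏ D Y)) (⟦⊆?⟧≡∏ Y (⊤ ∩ ∁ C)))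
                                                 (neg1^ℤ∣∣≡∏ (C ∩ ∁ X))) (neg1^ℤ∣∣≡∏ (Y ∩ ∁ D))) ⟩
      ((((∏ℤ n f₁ * ∏ℤ n f₂) * ∏ℤ n f₃) * ∏ℤ n f₄) * ∏ℤ n f₅) * v X Y
        ≡⟨ cong (_* v X Y) factors-merge ⟩
      ∏ℤ n (λ i → mobiusFactor (lookup C i) (lookup D i) (lookup X i) (lookup Y i)) * v X Y ∎
      where
        ⟦∧⟧ : ∀ a b → ⟦ a ∧ b ⟧ ≡ ⟦ a ⟧ * ⟦ b ⟧
        ⟦∧⟧ true  b = sym (*-identityˡ _)
        ⟦∧⟧ false b = sym (zeroˡ _)
        sign≡ : neg1^ (∣ C ∩ ∁ X ∣ +ℕ ∣ Y ∩ ∁ D ∣) ≡ ι (neg1^ℤ ∣ C ∩ ∁ X ∣) * ι (neg1^ℤ ∣ Y ∩ ∁ D ∣)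
        sign≡ = trans (neg1^≡ι n (∣ C ∩ ∁ X ∣ +ℕ ∣ Y ∩ ∁ D ∣))
                  (trans (cong ι (neg1^ℤ-+ ∣ C ∩ ∁ X ∣ ∣ Y ∩ ∁ D ∣)) (ι-* (neg1^ℤ ∣ C ∩ ∁ X ∣) (neg1^ℤ ∣ Y ∩ ∁ D ∣)))
        f₁ = λ i → 𝟙 (lookup X i ⇒ᵇ lookup C i)
        f₂ = λ i → 𝟙 (lookup D i ⇒ᵇ lookup Y i)
        f₃ = λ i → 𝟙 (lookup Y i ⇒ᵇ lookup (⊤ ∩ ∁ C) i)
        f₄ = λ i → sgn (lookup (C ∩ ∁ X) i)
        f₅ = λ i → sgn (lookup (Y ∩ ∁ D) i)
        pointwise : ∀ i → f₁ i ℤ.* f₂ i ℤ.* f₃ i ℤ.* f₄ i ℤ.* f₅ i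
                          ≡ mobiusFactor (lookup C i) (lookup D i) (lookup X i) (lookup Y i)
        pointwise i rewrite lookup-∖ ⊤ C i | lookup-⊤ {n} i | lookup-∖ C X i | lookup-∖ Y D i = refl
        factors-merge : (((∏ℤ n f₁ * ∏ℤ n f₂) * ∏ℤ n f₃) * ∏ℤ n f₄) * ∏ℤ n f₅
                        ≡ ∏ℤ n (λ i → mobiusFactor (lookup C i) (lookup D i) (lookup X i) (lookup Y i))
        factors-merge = begin
          (((∏ℤ n f₁ * ∏ℤ n f₂) * ∏ℤ n f₃) * ∏ℤ n f₄) * ∏ℤ n f₅
            ≡⟨ cong (λ t → ((t * ∏ℤ n f₃) * ∏ℤ n f₄) * ∏ℤ n f₅) (∏ℤ-* n f₁ f₂) ⟩
          ((∏ℤ n (λ i → f₁ i ℤ.* f₂ i) * ∏ℤ n f₃) * ∏ℤ n f₄) * ∏ℤ n f₅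
            ≡⟨ cong (λ t → (t * ∏ℤ n f₄) * ∏ℤ n f₅) (∏ℤ-* n (λ i → f₁ i ℤ.* f₂ i) f₃) ⟩
          (∏ℤ n (λ i → f₁ i ℤ.* f₂ i ℤ.* f₃ i) * ∏ℤ n f₄) * ∏ℤ n f₅
            ≡⟨ cong (_* ∏ℤ n f₅) (∏ℤ-* n (λ i → f₁ i ℤ.* f₂ i ℤ.* f₃ i) f₄) ⟩
          ∏ℤ n (λ i → f₁ i ℤ.* f₂ i ℤ.* f₃ i ℤ.* f₄ i) * ∏ℤ n f₅
            ≡⟨ ∏ℤ-* n (λ i → f₁ i ℤ.* f₂ i ℤ.* f₃ i ℤ.* f₄ i) f₅ ⟩
          ∏ℤ n (λ i → f₁ i ℤ.* f₂ i ℤ.* f₃ i ℤ.* f₄ i ℤ.* f₅ i)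
            ≡⟨ ∏ℤ-cong n pointwise ⟩
          ∏ℤ n (λ i → mobiusFactor (lookup C i) (lookup D i) (lookup X i) (lookup Y i)) ∎

    mobius≡∑² : ∀ C D →
      mobius v C D ≡ ∑² n (λ X Y → ∏ℤ n (λ i → mobiusFactor (lookup C i) (lookup D i) (lookup X i) (lookup Y i)) * v X Y)
    mobius≡∑² C D = begin
      mobius v C D
        ≡⟨ sumSub≡∑ n _ _ ⟩
      ∑ n (λ X → ⟦ does (X ⊆? C) ⟧ * Bicap.sumSub F n (λ Y → does (D ⊆? Y) ∧ does (Y ⊆? (⊤ ∩ ∁ C))) (term X))
        ≡⟨ ∑-cong n (λ X → cong (⟦ does (X ⊆? C) ⟧ *_) (sumSub≡∑ n _ _)) ⟩
      ∑ n (λ X → ⟦ does (X ⊆? C) ⟧ * ∑ n (λ Y → ⟦ does (D ⊆? Y) ∧ does (Y ⊆? (⊤ ∩ ∁ C)) ⟧ * term X Y))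
        ≡⟨ ∑-cong n (λ X → sym (∑-*ˡ n _ _)) ⟩
      ∑² n (λ X Y → ⟦ does (X ⊆? C) ⟧ * (⟦ does (D ⊆? Y) ∧ does (Y ⊆? (⊤ ∩ ∁ C)) ⟧ * term X Y))
        ≡⟨ ∑²-cong n (mobius-summand≡∏ C D) ⟩
      ∑² n (λ X Y → ∏ℤ n (λ i → mobiusFactor (lookup C i) (lookup D i) (lookup X i) (lookup Y i)) * v X Y) ∎
      where term = λ X Y → neg1^ (∣ C ∩ ∁ X ∣ +ℕ ∣ Y ∩ ∁ D ∣) * v X Y

  inversionFactor : Bool → Bool → Bool → Bool → Bool → Bool → ℤ
  inversionFactor a b c d x y = 𝟙 ((c ∧ d) ⇒ᵇ false) ℤ.* (mobiusFactor c d x y ℤ.* (𝟙 (c ⇒ᵇ a) ℤ.* 𝟙 (b ⇒ᵇ d)))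

  inversionFactor-sum : ∀ a b x y → a ∧ b ≡ false →
    inversionFactor a b true true x y ℤ.+ inversionFactor a b true false x y
      ℤ.+ (inversionFactor a b false true x y ℤ.+ inversionFactor a b false false x y)
    ≡ 𝟙 (a ⇔ᵇ x) ℤ.* 𝟙 (b ⇔ᵇ y)
  inversionFactor-sum true  true  x     y     ()
  inversionFactor-sum true  false true  true  _ = refl
  inversionFactor-sum true  false true  false _ = refl
  inversionFactor-sum true  false false true  _ = refl
  inversionFactor-sum true  false false false _ = refl
  inversionFactor-sum false true  true  true  _ = refl
  inversionFactor-sum false true  true  false _ = refl
  inversionFactor-sum false true  false true  _ = refl
  inversionFactor-sum false true  false false _ = refl
  inversionFactor-sum false false true  true  _ = refl
  inversionFactor-sum false false true  false _ = refl
  inversionFactor-sum false false false true  _ = refl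
  inversionFactor-sum false false false false _ = refl

  disjoint⇒lookup : ∀ {m} (A B : Subset m) → A ∩ B ≡ ⊥ → ∀ i → lookup A i ∧ lookup B i ≡ false
  disjoint⇒lookup A B A∩B≡⊥ i = trans (sym (lookup-∩ A B i)) (trans (cong (λ V → lookup V i) A∩B≡⊥) (lookup-⊥ i))

  inversion-summand≡∏ : ∀ n (A B C D X Y : Subset n) →
    ⟦ disjoint? C D ⟧ * (∏ℤ n (λ i → mobiusFactor (lookup C i) (lookup D i) (lookup X i) (lookup Y i)) * unanimity C D A B)
    ≡ ∏ℤ n (λ i → inversionFactor (lookup A i) (lookup B i) (lookup C i) (lookup D i) (lookup X i) (lookup Y i))
  inversion-summand≡∏ n A B C D X Y = begin
    ⟦ disjoint? C D ⟧ * (∏ℤ n fμ * (⟦ does (C ⊆? A) ⟧ * ⟦ does (B ⊆? D) ⟧))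
      ≡⟨ cong₂ (λ a b → a * (∏ℤ n fμ * b)) (⟦⊆?⟧≡∏ (C ∩ D) ⊥) (cong₂ _*_ (⟦⊆?⟧≡∏ C A) (⟦⊆?⟧≡∏ B D)) ⟩
    ∏ℤ n f₁ * (∏ℤ n fμ * (∏ℤ n f₂ * ∏ℤ n f₃))
      ≡⟨ cong (λ t → ∏ℤ n f₁ * (∏ℤ n fμ * t)) (∏ℤ-* n f₂ f₃) ⟩
    ∏ℤ n f₁ * (∏ℤ n fμ * ∏ℤ n (λ i → f₂ i ℤ.* f₃ i))
      ≡⟨ cong (∏ℤ n f₁ *_) (∏ℤ-* n fμ (λ i → f₂ i ℤ.* f₃ i)) ⟩
    ∏ℤ n f₁ * ∏ℤ n (λ i → fμ i ℤ.* (f₂ i ℤ.* f₃ i))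
      ≡⟨ ∏ℤ-* n f₁ (λ i → fμ i ℤ.* (f₂ i ℤ.* f₃ i)) ⟩
    ∏ℤ n (λ i → f₁ i ℤ.* (fμ i ℤ.* (f₂ i ℤ.* f₃ i)))
      ≡⟨ ∏ℤ-cong n pointwise ⟩
    ∏ℤ n (λ i → inversionFactor (lookup A i) (lookup B i) (lookup C i) (lookup D i) (lookup X i) (lookup Y i)) ∎
    where
      fμ = λ i → mobiusFactor (lookup C i) (lookup D i) (lookup X i) (lookup Y i)
      f₁ = λ i → 𝟙 (lookup (C ∩ D) i ⇒ᵇ lookup (⊥ {n}) i)
      f₂ = λ i → 𝟙 (lookup C i ⇒ᵇ lookup A i)
      f₃ = λ i → 𝟙 (lookup B i ⇒ᵇ lookup D i)
      pointwise : ∀ i → f₁ i ℤ.* (fμ i ℤ.* (f₂ i ℤ.* f₃ i))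
                        ≡ inversionFactor (lookup A i) (lookup B i) (lookup C i) (lookup D i) (lookup X i) (lookup Y i)
      pointwise i rewrite lookup-∩ C D i | lookup-⊥ {n} i = refl

  -- The Möbius transform of the paper is defined on Q(N) only; mobiusQ is its extension by 0.
  mobiusQ : ∀ n → (Subset n → Subset n → Carrier) → Subset n → Subset n → Carrier
  mobiusQ n v C D = ⟦ disjoint? C D ⟧ * Bicap.mobius F n v C D

  mobius-inversion : ∀ n (v : Subset n → Subset n → Carrier) A B → A ∩ B ≡ ⊥ →
    v A B ≡ ∑² n (λ C D → mobiusQ n v C D * unanimity C D A B)
  mobius-inversion n v A B A∩B≡⊥ = sym (begin
    ∑² n (λ C D → mobiusQ n v C D * unanimity C D A B)
      ≡⟨ ∑²-cong n (λ C D → trans (*-assoc _ _ _) (cong (λ t → ⟦ disjoint? C D ⟧ * (t * unanimity C D A B)) (mobius≡∑² n v C D))) ⟩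
    ∑² n (λ C D → ⟦ disjoint? C D ⟧ * (∑² n (λ X Y → M C D X Y * v X Y) * unanimity C D A B))
      ≡⟨ ∑²-cong n (λ C D → trans (cong (⟦ disjoint? C D ⟧ *_) (sym (∑²-*ʳ n _ _))) (sym (∑²-*ˡ n _ _))) ⟩
    ∑² n (λ C D → ∑² n (λ X Y → ⟦ disjoint? C D ⟧ * ((M C D X Y * v X Y) * unanimity C D A B)))
      ≡⟨ ∑²-cong n (λ C D → ∑²-cong n (λ X Y → trans (reorder _ _ _ _) (cong (_* v X Y) (inversion-summand≡∏ n A B C D X Y)))) ⟩
    ∑² n (λ C D → ∑² n (λ X Y → K C D X Y * v X Y))
      ≡⟨ ∑²-comm n (λ C D X Y → K C D X Y * v X Y) ⟩
    ∑² n (λ X Y → ∑² n (λ C D → K C D X Y * v X Y))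
      ≡⟨ ∑²-cong n (λ X Y → ∑²-*ʳ n (v X Y) (λ C D → K C D X Y)) ⟩
    ∑² n (λ X Y → ∑² n (λ C D → K C D X Y) * v X Y)
      ≡⟨ ∑²-cong n (λ X Y → cong (_* v X Y) (trans (∑²-∏ n (λ i c d → inversionFactor (a i) (b i) c d (lookup X i) (lookup Y i)))
           (∏-cong n (λ i → cong ι (inversionFactor-sum (a i) (b i) (lookup X i) (lookup Y i) (disjoint⇒lookup A B A∩B≡⊥ i)))))) ⟩
    ∑² n (λ X Y → ∏ℤ n (λ i → 𝟙 (a i ⇔ᵇ lookup X i) ℤ.* 𝟙 (b i ⇔ᵇ lookup Y i)) * v X Y)
      ≡⟨ ∑²-δ n A B v ⟩
    v A B ∎)
    where
      a = lookup A
      b = lookup B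
      M = λ (C D X Y : Subset n) → ∏ℤ n (λ i → mobiusFactor (lookup C i) (lookup D i) (lookup X i) (lookup Y i))
      K = λ (C D X Y : Subset n) → ∏ℤ n (λ i → inversionFactor (a i) (b i) (lookup C i) (lookup D i) (lookup X i) (lookup Y i))
      reorder : ∀ j m v g → j * ((m * v) * g) ≡ (j * (m * g)) * v
      reorder = solve 4 (λ j m v g → (j :* ((m :* v) :* g)) := ((j :* (m :* g)) :* v)) refl

  -- Linearity of the interaction transform

  ∑³ : ∀ m → (Subset m → Subset m → Subset m → Carrier) → Carrier
  ∑³ m f = ∑ m (λ K → ∑² m (λ X Y → f K X Y))

  ∑³-cong : ∀ m {f g : Subset m → Subset m → Subset m → Carrier} → (∀ K X Y → f K X Y ≡ g K X Y) → ∑³ m f ≡ ∑³ m g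
  ∑³-cong m f≗g = ∑-cong m (λ K → ∑²-cong m (f≗g K))

  ∑³-*ˡ : ∀ m c (f : Subset m → Subset m → Subset m → Carrier) → ∑³ m (λ K X Y → c * f K X Y) ≡ c * ∑³ m f
  ∑³-*ˡ m c f = trans (∑-cong m (λ K → ∑²-*ˡ m c _)) (∑-*ˡ m c _)

  ∑-∑²-comm : ∀ m (f : Subset m → Subset m → Subset m → Carrier) →
              ∑ m (λ X → ∑² m (λ C D → f X C D)) ≡ ∑² m (λ C D → ∑ m (λ X → f X C D))
  ∑-∑²-comm m f = trans (∑-comm m m _) (∑-cong m (λ C → ∑-comm m m _))

  ∑³-∑²-comm : ∀ m (f : Subset m → Subset m → Subset m → Subset m → Subset m → Carrier) →
               ∑³ m (λ K X Y → ∑² m (λ C D → f K X Y C D)) ≡ ∑² m (λ C D → ∑³ m (λ K X Y → f K X Y C D))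
  ∑³-∑²-comm m f = begin
    ∑ m (λ K → ∑ m (λ X → ∑ m (λ Y → ∑² m (λ C D → f K X Y C D)))) ≡⟨ ∑-cong m (λ K → ∑-cong m (λ X → ∑-∑²-comm m _)) ⟩
    ∑ m (λ K → ∑ m (λ X → ∑² m (λ C D → ∑ m (λ Y → f K X Y C D)))) ≡⟨ ∑-cong m (λ K → ∑-∑²-comm m _) ⟩
    ∑ m (λ K → ∑² m (λ C D → ∑ m (λ X → ∑ m (λ Y → f K X Y C D)))) ≡⟨ ∑-∑²-comm m _ ⟩
    ∑² m (λ C D → ∑³ m (λ K X Y → f K X Y C D))                       ∎

  module _ (n : ℕ) where
    open Bicap F n using (interaction; Δ; neg1^; fromℕ)

    interactionWeight : Subset n → Subset n → ℕ → Carrier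
    interactionWeight S T k = fromℕ (((n ∸ ∣ S ∣ ∸ ∣ T ∣) ∸ k) ! *ℕ (k !)) * inv (fromℕ ((suc (n ∸ ∣ S ∣ ∸ ∣ T ∣)) !))

    interactionCoefficient : (S T K S' T' : Subset n) → Carrier
    interactionCoefficient S T K S' T' =
      ⟦ does (S' ⊆? S) ⟧ * (((⟦ does (K ⊆? (⊤ ∩ ∁ (S ∪ T))) ⟧ * interactionWeight S T ∣ K ∣) * ⟦ does (T' ⊆? T) ⟧)
                            * neg1^ ((∣ S ∣ ∸ ∣ S' ∣) +ℕ (∣ T ∣ ∸ ∣ T' ∣)))

    interaction≡∑³ : ∀ v S T →
      interaction v S T ≡ ∑³ n (λ K S' T' → interactionCoefficient S T K S' T' * v (K ∪ S') ((⊤ ∩ ∁ (K ∪ S)) ∩ ∁ T'))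
    interaction≡∑³ v S T = begin
      interaction v S T
        ≡⟨ sumSub≡∑ n _ _ ⟩
      ∑ n (λ K → a K * (w K * Δ v S T K (⊤ ∩ ∁ (K ∪ S))))
        ≡⟨ ∑-cong n (λ K → cong (λ t → a K * (w K * t))
              (trans (sumSub≡∑ n _ _) (∑-cong n (λ S' → cong (⟦ does (S' ⊆? S) ⟧ *_) (sumSub≡∑ n _ _))))) ⟩
      ∑ n (λ K → a K * (w K * ∑ n (λ S' → ⟦ does (S' ⊆? S) ⟧ * ∑ n (λ T' → ⟦ does (T' ⊆? T) ⟧ * (σ S' T' * V K S' T')))))
        ≡⟨ ∑-cong n (λ K → trans (cong (a K *_) (sym (∑-*ˡ n _ _))) (sym (∑-*ˡ n _ _))) ⟩
      ∑ n (λ K → ∑ n (λ S' → a K * (w K * (⟦ does (S' ⊆? S) ⟧ * ∑ n (λ T' → ⟦ does (T' ⊆? T) ⟧ * (σ S' T' * V K S' T'))))))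
        ≡⟨ ∑-cong n (λ K → ∑-cong n (λ S' → trans (cong (λ t → a K * (w K * t)) (sym (∑-*ˡ n _ _)))
              (trans (cong (a K *_) (sym (∑-*ˡ n _ _))) (sym (∑-*ˡ n _ _))))) ⟩
      ∑³ n (λ K S' T' → a K * (w K * (⟦ does (S' ⊆? S) ⟧ * (⟦ does (T' ⊆? T) ⟧ * (σ S' T' * V K S' T')))))
        ≡⟨ ∑³-cong n (λ K S' T' →
             solve 6 (λ a w s t g v → (a :* (w :* (s :* (t :* (g :* v))))) := ((s :* (((a :* w) :* t) :* g)) :* v)) refl _ _ _ _ _ _) ⟩
      ∑³ n (λ K S' T' → interactionCoefficient S T K S' T' * V K S' T') ∎
      where
        a = λ (K : Subset n) → ⟦ does (K ⊆? (⊤ ∩ ∁ (S ∪ T))) ⟧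
        w = λ (K : Subset n) → interactionWeight S T ∣ K ∣
        σ = λ (S' T' : Subset n) → neg1^ ((∣ S ∣ ∸ ∣ S' ∣) +ℕ (∣ T ∣ ∸ ∣ T' ∣))
        V = λ (K S' T' : Subset n) → v (K ∪ S') ((⊤ ∩ ∁ (K ∪ S)) ∩ ∁ T')

    interactionCoefficient-*-cong : ∀ S T K S' T' {V V'} → (does (S' ⊆? S) ≡ true → V ≡ V') →
      interactionCoefficient S T K S' T' * V ≡ interactionCoefficient S T K S' T' * V'
    interactionCoefficient-*-cong S T K S' T' V≡V' =
      trans (*-assoc _ _ _) (trans (⟦⟧*-cong (does (S' ⊆? S)) (λ S'⊆S → cong (_ *_) (V≡V' S'⊆S))) (sym (*-assoc _ _ _)))

  ⊆?-∷ : ∀ {m} x y (A B : Subset m) → does ((x ∷ A) ⊆? (y ∷ B)) ≡ (x ⇒ᵇ y) ∧ does (A ⊆? B)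
  ⊆?-∷ false y     A B = refl
  ⊆?-∷ true  false A B = refl
  ⊆?-∷ true  true  A B = refl

  ∧≡true : ∀ a b → a ∧ b ≡ true → a ≡ true × b ≡ true
  ∧≡true true true refl = refl , refl

  ⊆?-∷⁻ : ∀ {m} x y (A B : Subset m) → does ((x ∷ A) ⊆? (y ∷ B)) ≡ true → (x ⇒ᵇ y) ≡ true × does (A ⊆? B) ≡ true
  ⊆?-∷⁻ x y A B h = ∧≡true _ _ (trans (sym (⊆?-∷ x y A B)) h)

  interaction-argument-disjoint : ∀ {m} (K S S' T' : Subset m) → does (S' ⊆? S) ≡ true →
    (K ∪ S') ∩ ((⊤ ∩ ∁ (K ∪ S)) ∩ ∁ T') ≡ ⊥
  interaction-argument-disjoint []       []       []         []       _ = refl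
  interaction-argument-disjoint (k ∷ K) (s ∷ S) (s' ∷ S') (t ∷ T') S'⊆S with ⊆?-∷⁻ s' s S' S S'⊆S
  ... | s'⇒s , S'⊆S′ = cong₂ _∷_ (head k s s' t s'⇒s) (interaction-argument-disjoint K S S' T' S'⊆S′)
    where
      head : ∀ k s s' t → (s' ⇒ᵇ s) ≡ true → (k ∨ s') ∧ ((true ∧ not (k ∨ s)) ∧ not t) ≡ false
      head false false false t _ = refl
      head false true  false t _ = refl
      head false true  true  t _ = refl
      head true  s     s'    t _ = refl
      head false false true  t ()

  module _ (n : ℕ) where
    open Bicap F n using (interaction)

    interaction-linear : ∀ v (c : Subset n → Subset n → Carrier) (h : Subset n → Subset n → Subset n → Subset n → Carrier) →
      (∀ A B → A ∩ B ≡ ⊥ → v A B ≡ ∑² n (λ C D → c C D * h C D A B)) →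
      ∀ S T → interaction v S T ≡ ∑² n (λ C D → c C D * interaction (h C D) S T)
    interaction-linear v c h v≡∑ S T = begin
      interaction v S T
        ≡⟨ interaction≡∑³ n v S T ⟩
      ∑³ n (λ K S' T' → κ K S' T' * v (K ∪ S') (L K T'))
        ≡⟨ ∑³-cong n (λ K S' T' → interactionCoefficient-*-cong n S T K S' T'
             (λ S'⊆S → v≡∑ _ _ (interaction-argument-disjoint K S S' T' S'⊆S))) ⟩
      ∑³ n (λ K S' T' → κ K S' T' * ∑² n (λ C D → c C D * h C D (K ∪ S') (L K T')))
        ≡⟨ ∑³-cong n (λ K S' T' → trans (sym (∑²-*ˡ n _ _))
             (∑²-cong n (λ C D → solve 3 (λ k c h → (k :* (c :* h)) := (c :* (k :* h))) refl _ _ _))) ⟩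
      ∑³ n (λ K S' T' → ∑² n (λ C D → c C D * (κ K S' T' * h C D (K ∪ S') (L K T'))))
        ≡⟨ ∑³-∑²-comm n _ ⟩
      ∑² n (λ C D → ∑³ n (λ K S' T' → c C D * (κ K S' T' * h C D (K ∪ S') (L K T'))))
        ≡⟨ ∑²-cong n (λ C D → trans (∑³-*ˡ n (c C D) _) (cong (c C D *_) (sym (interaction≡∑³ n (h C D) S T)))) ⟩
      ∑² n (λ C D → c C D * interaction (h C D) S T) ∎
      where
        κ = interactionCoefficient n S T
        L = λ (K T' : Subset n) → (⊤ ∩ ∁ (K ∪ S)) ∩ ∁ T'

    interaction-mobius : ∀ v S T → interaction v S T ≡ ∑² n (λ C D → mobiusQ n v C D * interaction (unanimity C D) S T)
    interaction-mobius v = interaction-linear v (mobiusQ n v) unanimity (mobius-inversion n v)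

  -- Characteristic zero and Beta weights

  0≤1 : 0# ≤ 1#
  0≤1 with total 0# 1#
  ... | inj₁ 0≤1 = 0≤1
  ... | inj₂ 1≤0 = ⊥-elim (0≢1 (sym (antisym 1≤0 0≤1′)))
    where
      0≤-1 : 0# ≤ - 1#
      0≤-1 = subst₂ _≤_ (-‿inverseʳ 1#) (+-identityˡ (- 1#)) (+-mono-≤ 1# 0# (- 1#) 1≤0)
      0≤1′ : 0# ≤ 1#
      0≤1′ = subst (0# ≤_) (solve 0 (con -[1+ 0 ] :* con -[1+ 0 ] := con (ℤ.+ 1)) refl) (*-nonneg (- 1#) (- 1#) 0≤-1 0≤-1)

  0≤ιℕ : ∀ k → 0# ≤ ιℕ k
  0≤ιℕ zero    = ≤-refl
  0≤ιℕ (suc k) = subst (0# ≤_) (sym (ιℕ-suc k))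
    (≤-trans 0≤1 (subst₂ _≤_ (+-identityˡ 1#) (+-comm (ιℕ k) 1#) (+-mono-≤ 0# (ιℕ k) 1# (0≤ιℕ k))))

  ιℕ-suc≢0 : ∀ k → ¬ ιℕ (suc k) ≡ 0#
  ιℕ-suc≢0 k 1+k≡0 = 0≢1 (sym (antisym 1≤0 0≤1))
    where
      k≡-1 : ιℕ k ≡ - 1#
      k≡-1 = begin
        ιℕ k                ≡⟨ solve 2 (λ a u → a := (u :+ a) :+ (:- u)) refl (ιℕ k) 1# ⟩
        (1# + ιℕ k) + - 1#  ≡⟨ cong (_+ - 1#) (trans (sym (ιℕ-suc k)) 1+k≡0) ⟩
        0# + - 1#           ≡⟨ +-identityˡ _ ⟩
        - 1#                ∎
      1≤0 : 1# ≤ 0#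
      1≤0 = subst₂ _≤_ (+-identityˡ 1#) (trans (+-comm (- 1#) 1#) (-‿inverseʳ 1#))
                       (+-mono-≤ 0# (- 1#) 1# (subst (0# ≤_) k≡-1 (0≤ιℕ k)))

  ιℕ≢0 : ∀ k → .{{NonZero k}} → ¬ ιℕ k ≡ 0#
  ιℕ≢0 (suc k) = ιℕ-suc≢0 k

  ιℕ-!≢0 : ∀ k → ¬ ιℕ (k !) ≡ 0#
  ιℕ-!≢0 k = ιℕ≢0 (k !) {{ℕ._!≢0 k}}

  inv-unique : ∀ x y → x * y ≡ 1# → y ≡ inv x
  inv-unique x y xy≡1 = begin
    y                ≡⟨ sym (*-identityˡ y) ⟩
    1# * y           ≡⟨ cong (_* y) (sym (trans (*-comm (inv x) x) (*-inv x x≢0))) ⟩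
    (inv x * x) * y  ≡⟨ *-assoc _ _ _ ⟩
    inv x * (x * y)  ≡⟨ cong (inv x *_) xy≡1 ⟩
    inv x * 1#       ≡⟨ *-identityʳ _ ⟩
    inv x            ∎
    where
      x≢0 : ¬ x ≡ 0#
      x≢0 x≡0 = 0≢1 (trans (sym (zeroˡ y)) (trans (cong (_* y) (sym x≡0)) xy≡1))

  inv-* : ∀ x y → ¬ x ≡ 0# → ¬ y ≡ 0# → inv (x * y) ≡ inv x * inv y
  inv-* x y x≢0 y≢0 = sym (inv-unique (x * y) (inv x * inv y) (begin
    (x * y) * (inv x * inv y)  ≡⟨ *-interchange x y (inv x) (inv y) ⟩
    (x * inv x) * (y * inv y)  ≡⟨ cong₂ _*_ (*-inv x x≢0) (*-inv y y≢0) ⟩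
    1# * 1#                    ≡⟨ *-identityʳ 1# ⟩
    1#                         ∎))

  inv-1 : inv 1# ≡ 1#
  inv-1 = sym (inv-unique 1# 1# (*-identityʳ 1#))

  ιℕ-*-inv-cancelˡ : ∀ k m z → .{{NonZero k}} → ¬ ιℕ z ≡ 0# → ιℕ (k *ℕ m) * inv (ιℕ (k *ℕ z)) ≡ ιℕ m * inv (ιℕ z)
  ιℕ-*-inv-cancelˡ k m z z≢0 = begin
    ιℕ (k *ℕ m) * inv (ιℕ (k *ℕ z))               ≡⟨ cong₂ (λ a b → a * inv b) (×1-homo-* k m) (×1-homo-* k z) ⟩
    (ιℕ k * ιℕ m) * inv (ιℕ k * ιℕ z)             ≡⟨ cong ((ιℕ k * ιℕ m) *_) (inv-* _ _ (ιℕ≢0 k) z≢0) ⟩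
    (ιℕ k * ιℕ m) * (inv (ιℕ k) * inv (ιℕ z))     ≡⟨ *-interchange _ _ _ _ ⟩
    (ιℕ k * inv (ιℕ k)) * (ιℕ m * inv (ιℕ z))     ≡⟨ cong (_* (ιℕ m * inv (ιℕ z))) (*-inv _ (ιℕ≢0 k)) ⟩
    1# * (ιℕ m * inv (ιℕ z))                      ≡⟨ *-identityˡ _ ⟩
    ιℕ m * inv (ιℕ z)                             ∎

  -- betaWeight r k = ∫₀¹ xᵏ (1 − x)ʳ⁻ᵏ dx and pascalSum f a b = Σⱼ (b choose j) f (a + j), so
  -- pascalSum-betaWeight is the binomial expansion of ∫₀¹ xᵃ (1 − x)^q (x + (1 − x))ᵇ dx.
  betaWeight : ℕ → ℕ → Carrier
  betaWeight r k = ιℕ ((r ∸ k) ! *ℕ k !) * inv (ιℕ (suc r !))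

  betaWeight-pascal : ∀ q a → betaWeight (suc (q +ℕ a)) a + betaWeight (suc (q +ℕ a)) (suc a) ≡ betaWeight (q +ℕ a) a
  betaWeight-pascal q a = begin
    ιℕ ((suc (q +ℕ a) ∸ a) ! *ℕ a !) * inv Z + ιℕ ((q +ℕ a ∸ a) ! *ℕ (suc a) !) * inv Z
      ≡⟨ cong₂ (λ x y → ιℕ (x ! *ℕ a !) * inv Z + ιℕ (y ! *ℕ (suc a) !) * inv Z) (ℕ.m+n∸n≡m (suc q) a) (ℕ.m+n∸n≡m q a) ⟩
    ιℕ ((suc q) ! *ℕ a !) * inv Z + ιℕ (q ! *ℕ (suc a) !) * inv Z
      ≡⟨ sym (distribʳ _ _ _) ⟩
    (ιℕ ((suc q) ! *ℕ a !) + ιℕ (q ! *ℕ (suc a) !)) * inv Z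
      ≡⟨ cong (_* inv Z) (trans (sym (×-homo-+ 1# ((suc q) ! *ℕ a !) (q ! *ℕ (suc a) !))) (cong ιℕ (factorial-pascal q a))) ⟩
    ιℕ (suc (suc (q +ℕ a)) *ℕ (q ! *ℕ a !)) * inv (ιℕ (suc (suc (q +ℕ a)) *ℕ (suc (q +ℕ a)) !))
      ≡⟨ ιℕ-*-inv-cancelˡ (suc (suc (q +ℕ a))) (q ! *ℕ a !) ((suc (q +ℕ a)) !) (ιℕ-!≢0 (suc (q +ℕ a))) ⟩
    ιℕ (q ! *ℕ a !) * inv (ιℕ ((suc (q +ℕ a)) !))
      ≡⟨ cong (λ x → ιℕ (x ! *ℕ a !) * inv (ιℕ ((suc (q +ℕ a)) !))) (sym (ℕ.m+n∸n≡m q a)) ⟩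
    betaWeight (q +ℕ a) a ∎
    where Z = ιℕ ((suc (suc (q +ℕ a))) !)

  betaWeight-diagonal : ∀ a → betaWeight a a ≡ inv (ιℕ (suc a))
  betaWeight-diagonal a = begin
    ιℕ ((a ∸ a) ! *ℕ a !) * inv (ιℕ (suc a *ℕ a !))        ≡⟨ cong (λ x → ιℕ (x ! *ℕ a !) * inv (ιℕ (suc a *ℕ a !))) (ℕ.n∸n≡0 a) ⟩
    ιℕ (1 *ℕ a !) * inv (ιℕ (suc a *ℕ a !))                ≡⟨ cong₂ (λ x y → x * inv y) (×1-homo-* 1 (a !)) (×1-homo-* (suc a) (a !)) ⟩
    (1# * ιℕ (a !)) * inv (ιℕ (suc a) * ιℕ (a !))          ≡⟨ cong₂ _*_ (*-identityˡ _) (inv-* _ _ (ιℕ-suc≢0 a) (ιℕ-!≢0 a)) ⟩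
    ιℕ (a !) * (inv (ιℕ (suc a)) * inv (ιℕ (a !)))         ≡⟨ solve 3 (λ x y z → (x :* (y :* z)) := (y :* (x :* z))) refl _ _ _ ⟩
    inv (ιℕ (suc a)) * (ιℕ (a !) * inv (ιℕ (a !)))         ≡⟨ cong (inv (ιℕ (suc a)) *_) (*-inv _ (ιℕ-!≢0 a)) ⟩
    inv (ιℕ (suc a)) * 1#                                  ≡⟨ *-identityʳ _ ⟩
    inv (ιℕ (suc a))                                       ∎

  pascalSum : (ℕ → Carrier) → ℕ → ℕ → Carrier
  pascalSum f a zero    = f a
  pascalSum f a (suc b) = pascalSum f a b + pascalSum f (suc a) b

  pascalSum-shift : ∀ f a b → pascalSum (λ k → f (suc k)) a b ≡ pascalSum f (suc a) b
  pascalSum-shift f a zero    = refl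
  pascalSum-shift f a (suc b) = cong₂ _+_ (pascalSum-shift f a b) (pascalSum-shift f (suc a) b)

  pascalSum-cong : ∀ {f g} a b → (∀ k → f k ≡ g k) → pascalSum f a b ≡ pascalSum g a b
  pascalSum-cong a zero    f≗g = f≗g a
  pascalSum-cong a (suc b) f≗g = cong₂ _+_ (pascalSum-cong a b f≗g) (pascalSum-cong (suc a) b f≗g)

  pascalSum-betaWeight : ∀ b q a → pascalSum (betaWeight (b +ℕ (q +ℕ a))) a b ≡ betaWeight (q +ℕ a) a
  pascalSum-betaWeight zero    q a = refl
  pascalSum-betaWeight (suc b) q a = begin
    pascalSum (betaWeight (suc b +ℕ (q +ℕ a))) a b + pascalSum (betaWeight (suc b +ℕ (q +ℕ a))) (suc a) b
      ≡⟨ cong₂ _+_ (trans (cong (λ r → pascalSum (betaWeight r) a b) (sym (ℕ.+-suc b (q +ℕ a)))) (pascalSum-betaWeight b (suc q) a))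
                   (trans (cong (λ r → pascalSum (betaWeight r) (suc a) b) r≡) (pascalSum-betaWeight b q (suc a))) ⟩
    betaWeight (suc (q +ℕ a)) a + betaWeight (q +ℕ suc a) (suc a)
      ≡⟨ cong (λ r → betaWeight (suc (q +ℕ a)) a + betaWeight r (suc a)) (ℕ.+-suc q a) ⟩
    betaWeight (suc (q +ℕ a)) a + betaWeight (suc (q +ℕ a)) (suc a)
      ≡⟨ betaWeight-pascal q a ⟩
    betaWeight (q +ℕ a) a ∎
    where
      r≡ : suc b +ℕ (q +ℕ a) ≡ b +ℕ (q +ℕ suc a)
      r≡ = trans (sym (ℕ.+-suc b (q +ℕ a))) (cong (b +ℕ_) (sym (ℕ.+-suc q a)))

  pascalSum-betaWeight≡inv : ∀ a b → pascalSum (betaWeight (b +ℕ a)) a b ≡ inv (ιℕ (suc a))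
  pascalSum-betaWeight≡inv a b = trans (pascalSum-betaWeight b 0 a) (betaWeight-diagonal a)

  -- The interaction transform of unanimity games

  ∑-roles : ∀ m (ρ : Fin m → Role) (f : ℕ → Carrier) →
    ∑ m (λ K → f ∣ K ∣ * ∏ℤ m (λ i → roleFactor (ρ i) (lookup K i)))
    ≡ ∏ℤ m (λ i → roleConstant (ρ i)) * pascalSum f (count m (λ i → isForced (ρ i))) (count m (λ i → isFree (ρ i)))
  ∑-roles zero    ρ f = *-comm _ _
  ∑-roles (suc m) ρ f with ρ zero
  ... | fixed g = begin
    ∑ m (λ K → f (suc ∣ K ∣) * (0# * P K)) + ∑ m (λ K → f ∣ K ∣ * (ι g * P K))
      ≡⟨ cong₂ _+_ (trans (∑-cong m (λ K → trans (cong (f (suc ∣ K ∣) *_) (zeroˡ _)) (zeroʳ _))) (∑-0 m))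
                   (∑-cong m (λ K → solve 3 (λ a b c → (a :* (b :* c)) := (b :* (a :* c))) refl _ _ _)) ⟩
    0# + ∑ m (λ K → ι g * (f ∣ K ∣ * P K)) ≡⟨ trans (+-identityˡ _) (∑-*ˡ m _ _) ⟩
    ι g * ∑ m (λ K → f ∣ K ∣ * P K)         ≡⟨ cong (ι g *_) (∑-roles m (λ i → ρ (suc i)) f) ⟩
    ι g * (Γ * pascalSum f a b)            ≡⟨ sym (*-assoc _ _ _) ⟩
    (ι g * Γ) * pascalSum f a b            ∎
    where
      P = λ (K : Subset m) → ∏ℤ m (λ i → roleFactor (ρ (suc i)) (lookup K i))
      Γ = ∏ℤ m (λ i → roleConstant (ρ (suc i)))
      a = count m (λ i → isForced (ρ (suc i)))
      b = count m (λ i → isFree (ρ (suc i)))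
  ... | free = begin
    ∑ m (λ K → f (suc ∣ K ∣) * (1# * P K)) + ∑ m (λ K → f ∣ K ∣ * (1# * P K))
      ≡⟨ cong₂ _+_ (∑-cong m (λ K → cong (f (suc ∣ K ∣) *_) (*-identityˡ _))) (∑-cong m (λ K → cong (f ∣ K ∣ *_) (*-identityˡ _))) ⟩
    ∑ m (λ K → f (suc ∣ K ∣) * P K) + ∑ m (λ K → f ∣ K ∣ * P K)
      ≡⟨ cong₂ _+_ (∑-roles m (λ i → ρ (suc i)) (λ k → f (suc k))) (∑-roles m (λ i → ρ (suc i)) f) ⟩
    Γ * pascalSum (λ k → f (suc k)) a b + Γ * pascalSum f a b ≡⟨ cong (λ t → Γ * t + Γ * pascalSum f a b) (pascalSum-shift f a b) ⟩
    Γ * pascalSum f (suc a) b + Γ * pascalSum f a b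
      ≡⟨ solve 3 (λ g x y → (g :* y :+ g :* x) := ((con (ℤ.+ 1) :* g) :* (x :+ y))) refl _ _ _ ⟩
    (1# * Γ) * (pascalSum f a b + pascalSum f (suc a) b) ∎
    where
      P = λ (K : Subset m) → ∏ℤ m (λ i → roleFactor (ρ (suc i)) (lookup K i))
      Γ = ∏ℤ m (λ i → roleConstant (ρ (suc i)))
      a = count m (λ i → isForced (ρ (suc i)))
      b = count m (λ i → isFree (ρ (suc i)))
  ... | forced = begin
    ∑ m (λ K → f (suc ∣ K ∣) * (1# * P K)) + ∑ m (λ K → f ∣ K ∣ * (0# * P K))
      ≡⟨ cong₂ _+_ (∑-cong m (λ K → cong (f (suc ∣ K ∣) *_) (*-identityˡ _)))
                   (trans (∑-cong m (λ K → trans (cong (f ∣ K ∣ *_) (zeroˡ _)) (zeroʳ _))) (∑-0 m)) ⟩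
    ∑ m (λ K → f (suc ∣ K ∣) * P K) + 0#
      ≡⟨ trans (+-identityʳ _) (∑-roles m (λ i → ρ (suc i)) (λ k → f (suc k))) ⟩
    Γ * pascalSum (λ k → f (suc k)) a b ≡⟨ cong₂ _*_ (sym (*-identityˡ _)) (pascalSum-shift f a b) ⟩
    (1# * Γ) * pascalSum f (suc a) b    ∎
    where
      P = λ (K : Subset m) → ∏ℤ m (λ i → roleFactor (ρ (suc i)) (lookup K i))
      Γ = ∏ℤ m (λ i → roleConstant (ρ (suc i)))
      a = count m (λ i → isForced (ρ (suc i)))
      b = count m (λ i → isFree (ρ (suc i)))

  differenceFactor : Bool → Bool → Bool → Bool → Bool → Bool → Bool → ℤ
  differenceFactor s t k c d s' t' =
    𝟙 (s' ⇒ᵇ s) ℤ.* (𝟙 (t' ⇒ᵇ t) ℤ.* ((sgn (s ∧ not s') ℤ.* sgn (t ∧ not t'))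
      ℤ.* (𝟙 (c ⇒ᵇ (k ∨ s')) ℤ.* 𝟙 (((true ∧ not (k ∨ s)) ∧ not t') ⇒ᵇ d))))

  differenceFactorSum : Bool → Bool → Bool → Bool → Bool → ℤ
  differenceFactorSum s t k c d =
    differenceFactor s t k c d true true ℤ.+ differenceFactor s t k c d true false
      ℤ.+ (differenceFactor s t k c d false true ℤ.+ differenceFactor s t k c d false false)

  ∣∣-split-⊆ : ∀ {m} (S' S : Subset m) → does (S' ⊆? S) ≡ true → ∣ S ∣ ≡ ∣ S' ∣ +ℕ ∣ S ∩ ∁ S' ∣
  ∣∣-split-⊆ []         []        _    = refl
  ∣∣-split-⊆ (s' ∷ S') (s ∷ S) S'⊆S with ⊆?-∷⁻ s' s S' S S'⊆S
  ∣∣-split-⊆ (false ∷ S') (false ∷ S) _ | _ , S'⊆S = ∣∣-split-⊆ S' S S'⊆S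
  ∣∣-split-⊆ (false ∷ S') (true ∷ S)  _ | _ , S'⊆S = trans (cong suc (∣∣-split-⊆ S' S S'⊆S)) (sym (ℕ.+-suc _ _))
  ∣∣-split-⊆ (true ∷ S')  (true ∷ S)  _ | _ , S'⊆S = cong suc (∣∣-split-⊆ S' S S'⊆S)
  ∣∣-split-⊆ (true ∷ S')  (false ∷ S) _ | () , _

  ∣∣-∸-⊆ : ∀ {m} (S' S : Subset m) → does (S' ⊆? S) ≡ true → ∣ S ∣ ∸ ∣ S' ∣ ≡ ∣ S ∩ ∁ S' ∣
  ∣∣-∸-⊆ S' S S'⊆S = trans (cong (_∸ ∣ S' ∣) (∣∣-split-⊆ S' S S'⊆S)) (ℕ.m+n∸m≡n ∣ S' ∣ _)

  module _ (n : ℕ) (C D S T K : Subset n) where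
    open Bicap F n using (neg1^)

    difference-summand≡∏ : ∀ S' T' →
      ⟦ does (S' ⊆? S) ⟧ * (⟦ does (T' ⊆? T) ⟧ * (neg1^ ((∣ S ∣ ∸ ∣ S' ∣) +ℕ (∣ T ∣ ∸ ∣ T' ∣))
                                                   * unanimity C D (K ∪ S') ((⊤ ∩ ∁ (K ∪ S)) ∩ ∁ T')))
      ≡ ∏ℤ n (λ i → differenceFactor (lookup S i) (lookup T i) (lookup K i) (lookup C i) (lookup D i) (lookup S' i) (lookup T' i))
    difference-summand≡∏ S' T' = begin
      ⟦ does (S' ⊆? S) ⟧ * (⟦ does (T' ⊆? T) ⟧ * (neg1^ ((∣ S ∣ ∸ ∣ S' ∣) +ℕ (∣ T ∣ ∸ ∣ T' ∣)) * unanimity C D (K ∪ S') L'))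
        ≡⟨ ⟦⟧*-cong (does (S' ⊆? S)) (λ S'⊆S → ⟦⟧*-cong (does (T' ⊆? T)) (λ T'⊆T → cong (_* unanimity C D (K ∪ S') L') (sign≡ S'⊆S T'⊆T))) ⟩
      ⟦ does (S' ⊆? S) ⟧ * (⟦ does (T' ⊆? T) ⟧ * ((ι (neg1^ℤ ∣ S ∩ ∁ S' ∣) * ι (neg1^ℤ ∣ T ∩ ∁ T' ∣))
                                                  * (⟦ does (C ⊆? (K ∪ S')) ⟧ * ⟦ does (L' ⊆? D) ⟧)))
        ≡⟨ cong₂ _*_ (⟦⊆?⟧≡∏ S' S) (cong₂ _*_ (⟦⊆?⟧≡∏ T' T)
             (cong₂ _*_ (cong₂ _*_ (neg1^ℤ∣∣≡∏ (S ∩ ∁ S')) (neg1^ℤ∣∣≡∏ (T ∩ ∁ T'))) (cong₂ _*_ (⟦⊆?⟧≡∏ C (K ∪ S')) (⟦⊆?⟧≡∏ L' D)))) ⟩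
      ∏ℤ n f₁ * (∏ℤ n f₂ * ((∏ℤ n f₃ * ∏ℤ n f₄) * (∏ℤ n f₅ * ∏ℤ n f₆)))
        ≡⟨ cong (λ t → ∏ℤ n f₁ * (∏ℤ n f₂ * t))
             (trans (cong₂ _*_ (∏ℤ-* n f₃ f₄) (∏ℤ-* n f₅ f₆)) (∏ℤ-* n (λ i → f₃ i ℤ.* f₄ i) (λ i → f₅ i ℤ.* f₆ i))) ⟩
      ∏ℤ n f₁ * (∏ℤ n f₂ * ∏ℤ n (λ i → (f₃ i ℤ.* f₄ i) ℤ.* (f₅ i ℤ.* f₆ i)))
        ≡⟨ trans (cong (∏ℤ n f₁ *_) (∏ℤ-* n f₂ _)) (∏ℤ-* n f₁ _) ⟩
      ∏ℤ n (λ i → f₁ i ℤ.* (f₂ i ℤ.* ((f₃ i ℤ.* f₄ i) ℤ.* (f₅ i ℤ.* f₆ i))))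
        ≡⟨ ∏ℤ-cong n pointwise ⟩
      ∏ℤ n (λ i → differenceFactor (lookup S i) (lookup T i) (lookup K i) (lookup C i) (lookup D i) (lookup S' i) (lookup T' i)) ∎
      where
        L' = (⊤ ∩ ∁ (K ∪ S)) ∩ ∁ T'
        sign≡ : does (S' ⊆? S) ≡ true → does (T' ⊆? T) ≡ true →
                neg1^ ((∣ S ∣ ∸ ∣ S' ∣) +ℕ (∣ T ∣ ∸ ∣ T' ∣)) ≡ ι (neg1^ℤ ∣ S ∩ ∁ S' ∣) * ι (neg1^ℤ ∣ T ∩ ∁ T' ∣)
        sign≡ S'⊆S T'⊆T = begin
          neg1^ ((∣ S ∣ ∸ ∣ S' ∣) +ℕ (∣ T ∣ ∸ ∣ T' ∣))      ≡⟨ neg1^≡ι n ((∣ S ∣ ∸ ∣ S' ∣) +ℕ (∣ T ∣ ∸ ∣ T' ∣)) ⟩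
          ι (neg1^ℤ ((∣ S ∣ ∸ ∣ S' ∣) +ℕ (∣ T ∣ ∸ ∣ T' ∣))) ≡⟨ cong₂ (λ x y → ι (neg1^ℤ (x +ℕ y))) (∣∣-∸-⊆ S' S S'⊆S) (∣∣-∸-⊆ T' T T'⊆T) ⟩
          ι (neg1^ℤ (∣ S ∩ ∁ S' ∣ +ℕ ∣ T ∩ ∁ T' ∣))         ≡⟨ cong ι (neg1^ℤ-+ ∣ S ∩ ∁ S' ∣ ∣ T ∩ ∁ T' ∣) ⟩
          ι (neg1^ℤ ∣ S ∩ ∁ S' ∣ ℤ.* neg1^ℤ ∣ T ∩ ∁ T' ∣)    ≡⟨ ι-* (neg1^ℤ ∣ S ∩ ∁ S' ∣) (neg1^ℤ ∣ T ∩ ∁ T' ∣) ⟩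
          ι (neg1^ℤ ∣ S ∩ ∁ S' ∣) * ι (neg1^ℤ ∣ T ∩ ∁ T' ∣) ∎
        f₁ = λ i → 𝟙 (lookup S' i ⇒ᵇ lookup S i)
        f₂ = λ i → 𝟙 (lookup T' i ⇒ᵇ lookup T i)
        f₃ = λ i → sgn (lookup (S ∩ ∁ S') i)
        f₄ = λ i → sgn (lookup (T ∩ ∁ T') i)
        f₅ = λ i → 𝟙 (lookup C i ⇒ᵇ lookup (K ∪ S') i)
        f₆ = λ i → 𝟙 (lookup L' i ⇒ᵇ lookup D i)
        pointwise : ∀ i → f₁ i ℤ.* (f₂ i ℤ.* ((f₃ i ℤ.* f₄ i) ℤ.* (f₅ i ℤ.* f₆ i)))
          ≡ differenceFactor (lookup S i) (lookup T i) (lookup K i) (lookup C i) (lookup D i) (lookup S' i) (lookup T' i)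
        pointwise i rewrite lookup-∖ S S' i | lookup-∖ T T' i | lookup-∪ K S' i | lookup-∖ (⊤ ∩ ∁ (K ∪ S)) T' i
                          | lookup-∖ ⊤ (K ∪ S) i | lookup-⊤ {n} i | lookup-∪ K S i = refl

    difference≡∏ :
      ∑² n (λ S' T' → ⟦ does (S' ⊆? S) ⟧ * (⟦ does (T' ⊆? T) ⟧ * (neg1^ ((∣ S ∣ ∸ ∣ S' ∣) +ℕ (∣ T ∣ ∸ ∣ T' ∣))
                                                                 * unanimity C D (K ∪ S') ((⊤ ∩ ∁ (K ∪ S)) ∩ ∁ T'))))
      ≡ ∏ℤ n (λ i → differenceFactorSum (lookup S i) (lookup T i) (lookup K i) (lookup C i) (lookup D i))
    difference≡∏ = trans (∑²-cong n difference-summand≡∏)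
                         (∑²-∏ n (λ i → differenceFactor (lookup S i) (lookup T i) (lookup K i) (lookup C i) (lookup D i)))

  role : Bool → Bool → Bool → Bool → Role
  role s t c d = if s ∨ t then fixed (differenceFactorSum s t false c d) else (if not c ∧ d then free else forced)

  roleFactor-role : ∀ s t k c d → 𝟙 (k ⇒ᵇ (true ∧ not (s ∨ t))) ℤ.* differenceFactorSum s t k c d ≡ roleFactor (role s t c d) k
  roleFactor-role true  t     true  c     d     = refl
  roleFactor-role true  t     false c     d     = ℤ.*-identityˡ _
  roleFactor-role false true  true  c     d     = refl
  roleFactor-role false true  false c     d     = ℤ.*-identityˡ _
  roleFactor-role false false true  true  true  = refl
  roleFactor-role false false true  true  false = refl
  roleFactor-role false false true  false true  = refl
  roleFactor-role false false true  false false = refl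
  roleFactor-role false false false true  true  = refl
  roleFactor-role false false false true  false = refl
  roleFactor-role false false false false true  = refl
  roleFactor-role false false false false false = refl

  roleConstant-role : ∀ s t c d → roleConstant (role s t c d) ≡ 𝟙 (s ⇒ᵇ c) ℤ.* 𝟙 (t ⇒ᵇ (true ∧ not (c ∨ d)))
  roleConstant-role true  true  true  true  = refl
  roleConstant-role true  true  true  false = refl
  roleConstant-role true  true  false true  = refl
  roleConstant-role true  true  false false = refl
  roleConstant-role true  false true  true  = refl
  roleConstant-role true  false true  false = refl
  roleConstant-role true  false false true  = refl
  roleConstant-role true  false false false = refl
  roleConstant-role false true  true  true  = refl
  roleConstant-role false true  true  false = refl
  roleConstant-role false true  false true  = refl
  roleConstant-role false true  false false = refl
  roleConstant-role false false true  true  = refl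
  roleConstant-role false false true  false = refl
  roleConstant-role false false false true  = refl
  roleConstant-role false false false false = refl

  isForced-role : ∀ s t c d → isForced (role s t c d) ≡ (c ∨ (true ∧ not (c ∨ d))) ∧ not (s ∨ t)
  isForced-role true  t     c     d     = sym (∧-zeroʳ _)
  isForced-role false true  c     d     = sym (∧-zeroʳ _)
  isForced-role false false true  d     = refl
  isForced-role false false false true  = refl
  isForced-role false false false false = refl

  roles : ∀ {m} → (S T C D : Subset m) → Fin m → Role
  roles S T C D i = role (lookup S i) (lookup T i) (lookup C i) (lookup D i)

  #free #forced : ∀ {m} → (S T C D : Subset m) → ℕ
  #free   {m} S T C D = count m (λ i → isFree (roles S T C D i))
  #forced {m} S T C D = count m (λ i → isForced (roles S T C D i))

  #free+#forced+∣S∣+∣T∣ : ∀ {m} (S T C D : Subset m) → S ∩ T ≡ ⊥ →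
    (#free S T C D +ℕ #forced S T C D) +ℕ (∣ S ∣ +ℕ ∣ T ∣) ≡ m
  #free+#forced+∣S∣+∣T∣ []       []       []       []       _ = refl
  #free+#forced+∣S∣+∣T∣ (s ∷ S) (t ∷ T) (c ∷ C) (d ∷ D) S∩T≡⊥ with ∷-injective S∩T≡⊥
  ... | s∧t≡false , S∩T≡⊥′ = step s t c d s∧t≡false
    where
      x = #free S T C D
      y = #forced S T C D
      z = ∣ S ∣ +ℕ ∣ T ∣
      IH = #free+#forced+∣S∣+∣T∣ S T C D S∩T≡⊥′
      step : ∀ s t c d → s ∧ t ≡ false →
        (#free (s ∷ S) (t ∷ T) (c ∷ C) (d ∷ D) +ℕ #forced (s ∷ S) (t ∷ T) (c ∷ C) (d ∷ D)) +ℕ (∣ s ∷ S ∣ +ℕ ∣ t ∷ T ∣) ≡ suc _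
      step true  true  c     d     ()
      step true  false c     d     _ = trans (ℕ.+-suc (x +ℕ y) z) (cong suc IH)
      step false true  c     d     _ = trans (cong ((x +ℕ y) +ℕ_) (ℕ.+-suc ∣ S ∣ ∣ T ∣)) (trans (ℕ.+-suc (x +ℕ y) z) (cong suc IH))
      step false false false true  _ = cong suc IH
      step false false true  d     _ = trans (cong (_+ℕ z) (ℕ.+-suc x y)) (cong suc IH)
      step false false false false _ = trans (cong (_+ℕ z) (ℕ.+-suc x y)) (cong suc IH)

  n∸∣S∣∸∣T∣≡#free+#forced : ∀ n (S T C D : Subset n) → S ∩ T ≡ ⊥ → n ∸ ∣ S ∣ ∸ ∣ T ∣ ≡ #free S T C D +ℕ #forced S T C D
  n∸∣S∣∸∣T∣≡#free+#forced n S T C D S∩T≡⊥ = begin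
    n ∸ ∣ S ∣ ∸ ∣ T ∣        ≡⟨ ℕ.∸-+-assoc n ∣ S ∣ ∣ T ∣ ⟩
    n ∸ (∣ S ∣ +ℕ ∣ T ∣)     ≡⟨ cong (_∸ (∣ S ∣ +ℕ ∣ T ∣)) (sym (#free+#forced+∣S∣+∣T∣ S T C D S∩T≡⊥)) ⟩
    ((#free S T C D +ℕ #forced S T C D) +ℕ (∣ S ∣ +ℕ ∣ T ∣)) ∸ (∣ S ∣ +ℕ ∣ T ∣) ≡⟨ ℕ.m+n∸n≡m _ (∣ S ∣ +ℕ ∣ T ∣) ⟩
    #free S T C D +ℕ #forced S T C D ∎

  neutral : ∀ {m} → Subset m → Subset m → Subset m
  neutral C D = ⊤ ∩ ∁ (C ∪ D)

  forcedSet : ∀ {m} → (C D S T : Subset m) → Subset m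
  forcedSet C D S T = (C ∪ neutral C D) ∩ ∁ (S ∪ T)

  module _ (n : ℕ) (C D S T : Subset n) where
    open Bicap F n using (interaction)

    interactionWeight≡betaWeight : ∀ k → interactionWeight n S T k ≡ betaWeight (n ∸ ∣ S ∣ ∸ ∣ T ∣) k
    interactionWeight≡betaWeight k =
      cong₂ (λ x y → x * inv y) (fromℕ≡ιℕ n (((n ∸ ∣ S ∣ ∸ ∣ T ∣) ∸ k) ! *ℕ k !)) (fromℕ≡ιℕ n (suc (n ∸ ∣ S ∣ ∸ ∣ T ∣) !))

    ∏-roleConstant : ∏ℤ n (λ i → roleConstant (roles S T C D i)) ≡ ⟦ does (S ⊆? C) ⟧ * ⟦ does (T ⊆? neutral C D) ⟧
    ∏-roleConstant = begin
      ∏ℤ n (λ i → roleConstant (roles S T C D i)) ≡⟨ ∏ℤ-cong n pointwise ⟩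
      ∏ℤ n (λ i → g₁ i ℤ.* g₂ i)                  ≡⟨ sym (∏ℤ-* n g₁ g₂) ⟩
      ∏ℤ n g₁ * ∏ℤ n g₂                           ≡⟨ sym (cong₂ _*_ (⟦⊆?⟧≡∏ S C) (⟦⊆?⟧≡∏ T (neutral C D))) ⟩
      ⟦ does (S ⊆? C) ⟧ * ⟦ does (T ⊆? neutral C D) ⟧ ∎
      where
        g₁ = λ i → 𝟙 (lookup S i ⇒ᵇ lookup C i)
        g₂ = λ i → 𝟙 (lookup T i ⇒ᵇ lookup (neutral C D) i)
        pointwise : ∀ i → roleConstant (roles S T C D i) ≡ g₁ i ℤ.* g₂ i
        pointwise i rewrite lookup-∖ ⊤ (C ∪ D) i | lookup-⊤ {n} i | lookup-∪ C D i =
          roleConstant-role (lookup S i) (lookup T i) (lookup C i) (lookup D i)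

    #forced≡∣forcedSet∣ : #forced S T C D ≡ ∣ forcedSet C D S T ∣
    #forced≡∣forcedSet∣ = trans (count-cong n _ _ pointwise) (count-lookup (forcedSet C D S T))
      where
        pointwise : ∀ i → isForced (roles S T C D i) ≡ lookup (forcedSet C D S T) i
        pointwise i rewrite lookup-∖ (C ∪ neutral C D) (S ∪ T) i | lookup-∪ C (neutral C D) i | lookup-∖ ⊤ (C ∪ D) i
                          | lookup-⊤ {n} i | lookup-∪ C D i | lookup-∪ S T i =
          isForced-role (lookup S i) (lookup T i) (lookup C i) (lookup D i)

    interaction-summand-roles : ∀ K →
      (⟦ does (K ⊆? (⊤ ∩ ∁ (S ∪ T))) ⟧ * interactionWeight n S T ∣ K ∣)
        * ∏ℤ n (λ i → differenceFactorSum (lookup S i) (lookup T i) (lookup K i) (lookup C i) (lookup D i))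
      ≡ interactionWeight n S T ∣ K ∣ * ∏ℤ n (λ i → roleFactor (roles S T C D i) (lookup K i))
    interaction-summand-roles K = begin
      (⟦ does (K ⊆? (⊤ ∩ ∁ (S ∪ T))) ⟧ * w) * ∏ℤ n fδ    ≡⟨ solve 3 (λ a w p → ((a :* w) :* p) := (w :* (a :* p))) refl _ _ _ ⟩
      w * (⟦ does (K ⊆? (⊤ ∩ ∁ (S ∪ T))) ⟧ * ∏ℤ n fδ)    ≡⟨ cong (λ t → w * (t * ∏ℤ n fδ)) (⟦⊆?⟧≡∏ K (⊤ ∩ ∁ (S ∪ T))) ⟩
      w * (∏ℤ n fK * ∏ℤ n fδ)                            ≡⟨ cong (w *_) (trans (∏ℤ-* n fK fδ) (∏ℤ-cong n pointwise)) ⟩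
      w * ∏ℤ n (λ i → roleFactor (roles S T C D i) (lookup K i)) ∎
      where
        w = interactionWeight n S T ∣ K ∣
        fδ = λ i → differenceFactorSum (lookup S i) (lookup T i) (lookup K i) (lookup C i) (lookup D i)
        fK = λ i → 𝟙 (lookup K i ⇒ᵇ lookup (⊤ ∩ ∁ (S ∪ T)) i)
        pointwise : ∀ i → fK i ℤ.* fδ i ≡ roleFactor (roles S T C D i) (lookup K i)
        pointwise i rewrite lookup-∖ ⊤ (S ∪ T) i | lookup-⊤ {n} i | lookup-∪ S T i =
          roleFactor-role (lookup S i) (lookup T i) (lookup K i) (lookup C i) (lookup D i)

    interaction-unanimity : S ∩ T ≡ ⊥ →
      interaction (unanimity C D) S T ≡ (⟦ does (S ⊆? C) ⟧ * ⟦ does (T ⊆? neutral C D) ⟧) * inv (ιℕ (suc ∣ forcedSet C D S T ∣))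
    interaction-unanimity S∩T≡⊥ = begin
      interaction (unanimity C D) S T
        ≡⟨ interaction≡∑³ n (unanimity C D) S T ⟩
      ∑³ n (λ K S' T' → interactionCoefficient n S T K S' T' * unanimity C D (K ∪ S') ((⊤ ∩ ∁ (K ∪ S)) ∩ ∁ T'))
        ≡⟨ ∑-cong n (λ K → trans (∑²-cong n (λ S' T' →
             solve 6 (λ s a w t σ u → ((s :* (((a :* w) :* t) :* σ)) :* u) := ((a :* w) :* (s :* (t :* (σ :* u))))) refl _ _ _ _ _ _))
             (trans (∑²-*ˡ n _ _) (cong (_ *_) (difference≡∏ n C D S T K)))) ⟩
      ∑ n (λ K → (⟦ does (K ⊆? (⊤ ∩ ∁ (S ∪ T))) ⟧ * interactionWeight n S T ∣ K ∣)
                 * ∏ℤ n (λ i → differenceFactorSum (lookup S i) (lookup T i) (lookup K i) (lookup C i) (lookup D i)))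
        ≡⟨ ∑-cong n interaction-summand-roles ⟩
      ∑ n (λ K → interactionWeight n S T ∣ K ∣ * ∏ℤ n (λ i → roleFactor (roles S T C D i) (lookup K i)))
        ≡⟨ ∑-roles n (roles S T C D) (interactionWeight n S T) ⟩
      ∏ℤ n (λ i → roleConstant (roles S T C D i)) * pascalSum (interactionWeight n S T) (#forced S T C D) (#free S T C D)
        ≡⟨ cong₂ _*_ ∏-roleConstant pascalSum≡ ⟩
      (⟦ does (S ⊆? C) ⟧ * ⟦ does (T ⊆? neutral C D) ⟧) * inv (ιℕ (suc ∣ forcedSet C D S T ∣)) ∎
      where
        a = #forced S T C D
        b = #free S T C D
        pascalSum≡ : pascalSum (interactionWeight n S T) a b ≡ inv (ιℕ (suc ∣ forcedSet C D S T ∣))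
        pascalSum≡ = begin
          pascalSum (interactionWeight n S T) a b      ≡⟨ pascalSum-cong a b interactionWeight≡betaWeight ⟩
          pascalSum (betaWeight (n ∸ ∣ S ∣ ∸ ∣ T ∣)) a b ≡⟨ cong (λ r → pascalSum (betaWeight r) a b) (n∸∣S∣∸∣T∣≡#free+#forced n S T C D S∩T≡⊥) ⟩
          pascalSum (betaWeight (b +ℕ a)) a b           ≡⟨ pascalSum-betaWeight≡inv a b ⟩
          inv (ιℕ (suc a))                              ≡⟨ cong (λ x → inv (ιℕ (suc x))) #forced≡∣forcedSet∣ ⟩
          inv (ιℕ (suc ∣ forcedSet C D S T ∣))          ∎

  ⊥⊆?_ : ∀ {m} (A : Subset m) → does (⊥ ⊆? A) ≡ true
  ⊥⊆? A = dec-true (⊥ ⊆? A) ⊥⊆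

  _⊆?⊤ : ∀ {m} (A : Subset m) → does (A ⊆? ⊤) ≡ true
  A ⊆?⊤ = dec-true (A ⊆? ⊤) ⊆⊤

  does⇒ : ∀ {A : Set} (a? : Dec A) → does a? ≡ true → A
  does⇒ (yes a) _ = a

  ⊆?⊥⇒≡⊥ : ∀ {m} (X : Subset m) → does (X ⊆? ⊥) ≡ true → X ≡ ⊥
  ⊆?⊥⇒≡⊥ []          _   = refl
  ⊆?⊥⇒≡⊥ (false ∷ X) X⊆⊥ = cong (false ∷_) (⊆?⊥⇒≡⊥ X X⊆⊥)
  ⊆?⊥⇒≡⊥ (true ∷ X)  ()

  ∣∪∣≡+ : ∀ {m} (S T : Subset m) → S ∩ T ≡ ⊥ → ∣ S ∪ T ∣ ≡ ∣ S ∣ +ℕ ∣ T ∣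
  ∣∪∣≡+ []       []       _     = refl
  ∣∪∣≡+ (s ∷ S) (t ∷ T) S∩T≡⊥ with ∷-injective S∩T≡⊥
  ∣∪∣≡+ (false ∷ S) (false ∷ T) _ | _  , S∩T≡⊥′ = ∣∪∣≡+ S T S∩T≡⊥′
  ∣∪∣≡+ (false ∷ S) (true ∷ T)  _ | _  , S∩T≡⊥′ = trans (cong suc (∣∪∣≡+ S T S∩T≡⊥′)) (sym (ℕ.+-suc _ _))
  ∣∪∣≡+ (true ∷ S)  (false ∷ T) _ | _  , S∩T≡⊥′ = cong suc (∣∪∣≡+ S T S∩T≡⊥′)
  ∣∪∣≡+ (true ∷ S)  (true ∷ T)  _ | () , _

  ⁅⁆∩⁅⁆≡⊥ : ∀ {m} (i j : Fin m) → ¬ i ≡ j → ⁅ i ⁆ ∩ ⁅ j ⁆ ≡ ⊥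
  ⁅⁆∩⁅⁆≡⊥ zero    zero    i≢j = ⊥-elim (i≢j refl)
  ⁅⁆∩⁅⁆≡⊥ zero    (suc j) _   = cong (false ∷_) (∩-zeroˡ ⁅ j ⁆)
  ⁅⁆∩⁅⁆≡⊥ (suc i) zero    _   = cong (false ∷_) (∩-zeroʳ ⁅ i ⁆)
  ⁅⁆∩⁅⁆≡⊥ (suc i) (suc j) i≢j = cong (false ∷_) (⁅⁆∩⁅⁆≡⊥ i j (λ i≡j → i≢j (cong suc i≡j)))

  ∪-mono-⊆? : ∀ {m} (S T A B : Subset m) → does (S ⊆? A) ≡ true → does (T ⊆? B) ≡ true → does ((S ∪ T) ⊆? (A ∪ B)) ≡ true
  ∪-mono-⊆? []       []       []       []       _   _   = refl
  ∪-mono-⊆? (s ∷ S) (t ∷ T) (a ∷ A) (b ∷ B) S⊆A T⊆B with ⊆?-∷⁻ s a S A S⊆A | ⊆?-∷⁻ t b T B T⊆B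
  ... | s⇒a , S⊆A′ | t⇒b , T⊆B′ =
    trans (⊆?-∷ (s ∨ t) (a ∨ b) (S ∪ T) (A ∪ B)) (cong₂ _∧_ (head s t a b s⇒a t⇒b) (∪-mono-⊆? S T A B S⊆A′ T⊆B′))
    where
      head : ∀ s t a b → (s ⇒ᵇ a) ≡ true → (t ⇒ᵇ b) ≡ true → ((s ∨ t) ⇒ᵇ (a ∨ b)) ≡ true
      head false false a     b     _  _  = refl
      head false true  true  b     _  _  = refl
      head false true  false true  _  _  = refl
      head true  t     true  b     _  _  = refl
      head false true  false false _  ()
      head true  t     false b     () _

  neutral-disjoint : ∀ {m} (C D : Subset m) → C ∩ neutral C D ≡ ⊥
  neutral-disjoint []          []      = refl
  neutral-disjoint (true ∷ C)  (_ ∷ D) = cong (false ∷_) (neutral-disjoint C D)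
  neutral-disjoint (false ∷ C) (_ ∷ D) = cong (false ∷_) (neutral-disjoint C D)

  ∣C∪E∣≡∣C∣+∣E∣ : ∀ {m} (C D : Subset m) → ∣ C ∪ neutral C D ∣ ≡ ∣ C ∣ +ℕ ∣ neutral C D ∣
  ∣C∪E∣≡∣C∣+∣E∣ C D = ∣∪∣≡+ C (neutral C D) (neutral-disjoint C D)

  ∣C∪E∣+∣D∣≡m : ∀ {m} (C D : Subset m) → C ∩ D ≡ ⊥ → ∣ C ∪ neutral C D ∣ +ℕ ∣ D ∣ ≡ m
  ∣C∪E∣+∣D∣≡m []       []       _ = refl
  ∣C∪E∣+∣D∣≡m (c ∷ C) (d ∷ D) C∩D≡⊥ with ∷-injective C∩D≡⊥
  ∣C∪E∣+∣D∣≡m (true ∷ C)  (true ∷ D)  _ | () , _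
  ∣C∪E∣+∣D∣≡m (true ∷ C)  (false ∷ D) _ | _  , C∩D≡⊥′ = cong suc (∣C∪E∣+∣D∣≡m C D C∩D≡⊥′)
  ∣C∪E∣+∣D∣≡m (false ∷ C) (true ∷ D)  _ | _  , C∩D≡⊥′ = trans (ℕ.+-suc _ _) (cong suc (∣C∪E∣+∣D∣≡m C D C∩D≡⊥′))
  ∣C∪E∣+∣D∣≡m (false ∷ C) (false ∷ D) _ | _  , C∩D≡⊥′ = cong suc (∣C∪E∣+∣D∣≡m C D C∩D≡⊥′)

  ∣forcedSet∣+∣S∪T∣ : ∀ {m} (C D S T : Subset m) → does (S ⊆? C) ≡ true → does (T ⊆? neutral C D) ≡ true →
    ∣ forcedSet C D S T ∣ +ℕ ∣ S ∪ T ∣ ≡ ∣ C ∪ neutral C D ∣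
  ∣forcedSet∣+∣S∪T∣ C D S T S⊆C T⊆E =
    trans (ℕ.+-comm ∣ forcedSet C D S T ∣ ∣ S ∪ T ∣) (sym (∣∣-split-⊆ (S ∪ T) (C ∪ neutral C D) (∪-mono-⊆? S T C (neutral C D) S⊆C T⊆E)))

  unanimity-N-∅ : ∀ {m} (C D : Subset m) → unanimity C D ⊤ ⊥ ≡ 1#
  unanimity-N-∅ C D = trans (cong₂ (λ a b → ⟦ a ⟧ * ⟦ b ⟧) (C ⊆?⊤) (⊥⊆? D)) (*-identityʳ 1#)

  unanimity-∅-N : ∀ {m} (C D : Subset m) → C ∩ D ≡ ⊥ → unanimity C D ⊥ ⊤ ≡ ⟦ ∣ C ∪ neutral C D ∣ ≡ᵇ 0 ⟧
  unanimity-∅-N []       []       _ = *-identityʳ 1#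
  unanimity-∅-N (c ∷ C) (d ∷ D) C∩D≡⊥ with ∷-injective C∩D≡⊥
  unanimity-∅-N (true ∷ C)  (true ∷ D)  _ | () , _
  unanimity-∅-N (true ∷ C)  (false ∷ D) _ | _  , _       = zeroˡ _
  unanimity-∅-N (false ∷ C) (true ∷ D)  _ | _  , C∩D≡⊥′ = unanimity-∅-N C D C∩D≡⊥′
  unanimity-∅-N (false ∷ C) (false ∷ D) _ | _  , _       = zeroʳ _

  ⟦⊆?⊥⟧ : ∀ {m} (C : Subset m) → ⟦ does (C ⊆? ⊥) ⟧ ≡ ⟦ ∣ C ∣ ≡ᵇ 0 ⟧
  ⟦⊆?⊥⟧ []          = refl
  ⟦⊆?⊥⟧ (true ∷ C)  = refl
  ⟦⊆?⊥⟧ (false ∷ C) = ⟦⊆?⊥⟧ C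

  unanimity-∅-∅ : ∀ {m} (C D : Subset m) → unanimity C D ⊥ ⊥ ≡ ⟦ ∣ C ∣ ≡ᵇ 0 ⟧
  unanimity-∅-∅ C D = trans (cong (λ b → ⟦ does (C ⊆? ⊥) ⟧ * ⟦ b ⟧) (⊥⊆? D)) (trans (*-identityʳ _) (⟦⊆?⊥⟧ C))

  ⟦⁅⁆⊆?C⟧*⟦⁅⁆⊆?E⟧≡0 : ∀ {m} (i : Fin m) (C D : Subset m) → ⟦ does (⁅ i ⁆ ⊆? C) ⟧ * ⟦ does (⁅ i ⁆ ⊆? neutral C D) ⟧ ≡ 0#
  ⟦⁅⁆⊆?C⟧*⟦⁅⁆⊆?E⟧≡0 zero    (true ∷ C)  (_ ∷ D) = zeroʳ _
  ⟦⁅⁆⊆?C⟧*⟦⁅⁆⊆?E⟧≡0 zero    (false ∷ C) (_ ∷ D) = zeroˡ _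
  ⟦⁅⁆⊆?C⟧*⟦⁅⁆⊆?E⟧≡0 (suc i) (_ ∷ C)     (_ ∷ D) = ⟦⁅⁆⊆?C⟧*⟦⁅⁆⊆?E⟧≡0 i C D

  sum-⟦⁅⁆⊆?⟧ : ∀ m (C : Subset m) → sum (λ i → ⟦ does (⁅ i ⁆ ⊆? C) ⟧) ≡ ιℕ ∣ C ∣
  sum-⟦⁅⁆⊆?⟧ zero    []          = refl
  sum-⟦⁅⁆⊆?⟧ (suc m) (true ∷ C)  = begin
    ⟦ does (⊥ ⊆? C) ⟧ + sum (λ i → ⟦ does (⁅ i ⁆ ⊆? C) ⟧) ≡⟨ cong₂ (λ a b → ⟦ a ⟧ + b) (⊥⊆? C) (sum-⟦⁅⁆⊆?⟧ m C) ⟩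
    1# + ιℕ ∣ C ∣                                        ≡⟨ sym (ιℕ-suc ∣ C ∣) ⟩
    ιℕ (suc ∣ C ∣)                                       ∎
  sum-⟦⁅⁆⊆?⟧ (suc m) (false ∷ C) = trans (+-identityˡ _) (sum-⟦⁅⁆⊆?⟧ m C)

  ∑-subsets-of-size : ∀ m k (C : Subset m) → ∑ m (λ S → ⟦ does (∣ S ∣ ≟ k) ⟧ * ⟦ does (S ⊆? C) ⟧) ≡ ιℕ (∣ C ∣ choose k)
  ∑-subsets-of-size zero    zero    []          = *-identityʳ 1#
  ∑-subsets-of-size zero    (suc k) []          = zeroˡ _
  ∑-subsets-of-size (suc m) k       (false ∷ C) = begin
    ∑ m (λ S → ⟦ does (suc ∣ S ∣ ≟ k) ⟧ * 0#) + ∑ m (λ S → ⟦ does (∣ S ∣ ≟ k) ⟧ * ⟦ does (S ⊆? C) ⟧)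
      ≡⟨ cong₂ _+_ (trans (∑-cong m (λ S → zeroʳ _)) (∑-0 m)) (∑-subsets-of-size m k C) ⟩
    0# + ιℕ (∣ C ∣ choose k) ≡⟨ +-identityˡ _ ⟩
    ιℕ (∣ C ∣ choose k)      ∎
  ∑-subsets-of-size (suc m) zero    (true ∷ C)  = begin
    ∑ m (λ S → 0# * ⟦ does (S ⊆? C) ⟧) + ∑ m (λ S → ⟦ does (∣ S ∣ ≟ 0) ⟧ * ⟦ does (S ⊆? C) ⟧)
      ≡⟨ cong₂ _+_ (trans (∑-cong m (λ S → zeroˡ _)) (∑-0 m)) (∑-subsets-of-size m zero C) ⟩
    0# + ιℕ (∣ C ∣ choose 0) ≡⟨ +-identityˡ _ ⟩
    ιℕ (suc ∣ C ∣ choose 0)  ∎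
  ∑-subsets-of-size (suc m) (suc k) (true ∷ C)  = begin
    ∑ m (λ S → ⟦ does (∣ S ∣ ≟ k) ⟧ * ⟦ does (S ⊆? C) ⟧) + ∑ m (λ S → ⟦ does (∣ S ∣ ≟ suc k) ⟧ * ⟦ does (S ⊆? C) ⟧)
      ≡⟨ cong₂ _+_ (∑-subsets-of-size m k C) (∑-subsets-of-size m (suc k) C) ⟩
    ιℕ (∣ C ∣ choose k) + ιℕ (∣ C ∣ choose suc k) ≡⟨ sym (×-homo-+ 1# (∣ C ∣ choose k) (∣ C ∣ choose suc k)) ⟩
    ιℕ (∣ C ∣ choose k +ℕ ∣ C ∣ choose suc k)     ≡⟨ cong ιℕ (nCk+nC[k+1]≡[n+1]C[k+1] ∣ C ∣ k) ⟩
    ιℕ (suc ∣ C ∣ choose suc k)                   ∎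

  module MobiusExpansion (n : ℕ) (v : Subset n → Subset n → Carrier) where
    open Bicap F n using (interaction; Is2Additive)

    ⟪_⟫ : (Subset n → Subset n → Carrier) → Carrier
    ⟪ f ⟫ = ∑² n (λ C D → mobiusQ n v C D * f C D)

    ⟪⟫-cong : ∀ {f g} → (∀ C D → C ∩ D ≡ ⊥ → f C D ≡ g C D) → ⟪ f ⟫ ≡ ⟪ g ⟫
    ⟪⟫-cong f≗g = ∑²-cong n (λ C D →
      trans (*-assoc _ _ _) (trans (⟦⟧*-cong (disjoint? C D) (λ C∩D⊆⊥ → cong (_ *_) (f≗g C D (⊆?⊥⇒≡⊥ (C ∩ D) C∩D⊆⊥))))
                                   (sym (*-assoc _ _ _))))

    ⟪⟫-+ : ∀ f g → ⟪ (λ C D → f C D + g C D) ⟫ ≡ ⟪ f ⟫ + ⟪ g ⟫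
    ⟪⟫-+ f g = trans (∑²-cong n (λ C D → distribˡ _ _ _)) (∑²-+ n _ _)

    ⟪⟫-*ˡ : ∀ c f → ⟪ (λ C D → c * f C D) ⟫ ≡ c * ⟪ f ⟫
    ⟪⟫-*ˡ c f = trans (∑²-cong n (λ C D → solve 3 (λ m c x → m :* (c :* x) := c :* (m :* x)) refl _ _ _)) (∑²-*ˡ n c _)

    ⟪⟫-- : ∀ f g → ⟪ (λ C D → f C D + - g C D) ⟫ ≡ ⟪ f ⟫ + - ⟪ g ⟫
    ⟪⟫-- f g = begin
      ⟪ (λ C D → f C D + - g C D) ⟫      ≡⟨ ⟪⟫-cong (λ C D _ → cong (f C D +_) (sym (-1*x≈-x (g C D)))) ⟩
      ⟪ (λ C D → f C D + - 1# * g C D) ⟫ ≡⟨ trans (⟪⟫-+ f _) (cong (⟪ f ⟫ +_) (⟪⟫-*ˡ (- 1#) g)) ⟩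
      ⟪ f ⟫ + - 1# * ⟪ g ⟫               ≡⟨ cong (⟪ f ⟫ +_) (-1*x≈-x ⟪ g ⟫) ⟩
      ⟪ f ⟫ + - ⟪ g ⟫                    ∎

    sum-⟪⟫ : ∀ (f : Fin n → Subset n → Subset n → Carrier) → sum (λ i → ⟪ f i ⟫) ≡ ⟪ (λ C D → sum (λ i → f i C D)) ⟫
    sum-⟪⟫ f = trans (sum-∑² n n _) (∑²-cong n (λ C D → sym (*-distribˡ-sum _ (λ i → f i C D))))

    ∑-⟪⟫ : ∀ (f : Subset n → Subset n → Subset n → Carrier) → ∑ n (λ S → ⟪ f S ⟫) ≡ ⟪ (λ C D → ∑ n (λ S → f S C D)) ⟫
    ∑-⟪⟫ f = trans (∑-∑²-comm n _) (∑²-cong n (λ C D → ∑-*ˡ n _ _))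

    width : Subset n → Subset n → ℕ
    width C D = ∣ C ∪ neutral C D ∣

    2-additive-support : Is2Additive v → ∀ C D → C ∩ D ≡ ⊥ → Bicap.mobius F n v C D ≡ 0# ⊎ width C D ≤ℕ 2
    2-additive-support 2-additive C D C∩D≡⊥ with ∣ D ∣ <? n ∸ 2
    ... | yes small = inj₁ (2-additive C D C∩D≡⊥ small)
    ... | no  large = inj₂ (≮∸2⇒≤2 (width C D) ∣ D ∣ (subst (λ k → ¬ ∣ D ∣ < k ∸ 2) (sym (∣C∪E∣+∣D∣≡m C D C∩D≡⊥)) large))

    ⟪⟫-cong-2additive : Is2Additive v → ∀ {f g} → (∀ C D → C ∩ D ≡ ⊥ → width C D ≤ℕ 2 → f C D ≡ g C D) → ⟪ f ⟫ ≡ ⟪ g ⟫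
    ⟪⟫-cong-2additive 2-additive {f} {g} f≗g = ∑²-cong n λ C D →
      trans (*-assoc _ _ _) (trans (⟦⟧*-cong (disjoint? C D) (λ C∩D⊆⊥ → summand C D (⊆?⊥⇒≡⊥ (C ∩ D) C∩D⊆⊥))) (sym (*-assoc _ _ _)))
      where
        summand : ∀ C D → C ∩ D ≡ ⊥ → Bicap.mobius F n v C D * f C D ≡ Bicap.mobius F n v C D * g C D
        summand C D C∩D≡⊥ with 2-additive-support 2-additive C D C∩D≡⊥
        ... | inj₁ m≡0  = trans (cong (_* f C D) m≡0) (trans (zeroˡ _) (sym (trans (cong (_* g C D) m≡0) (zeroˡ _))))
        ... | inj₂ narrow = cong (_ *_) (f≗g C D C∩D≡⊥ narrow)

    v-N-∅ : v ⊤ ⊥ ≡ ⟪ (λ _ _ → 1#) ⟫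
    v-N-∅ = trans (mobius-inversion n v ⊤ ⊥ (∩-zeroʳ ⊤)) (⟪⟫-cong (λ C D _ → unanimity-N-∅ C D))

    v-∅-N : v ⊥ ⊤ ≡ ⟪ (λ C D → ⟦ width C D ≡ᵇ 0 ⟧) ⟫
    v-∅-N = trans (mobius-inversion n v ⊥ ⊤ (∩-zeroˡ ⊤)) (⟪⟫-cong (λ C D → unanimity-∅-N C D))

    v-∅-∅ : v ⊥ ⊥ ≡ ⟪ (λ C D → ⟦ ∣ C ∣ ≡ᵇ 0 ⟧) ⟫
    v-∅-∅ = trans (mobius-inversion n v ⊥ ⊥ (∩-zeroʳ ⊥)) (⟪⟫-cong (λ C D _ → unanimity-∅-∅ C D))

    interaction-⟪⟫ : ∀ S T k → S ∩ T ≡ ⊥ → ∣ S ∪ T ∣ ≡ k →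
      interaction v S T ≡ ⟪ (λ C D → (⟦ does (S ⊆? C) ⟧ * ⟦ does (T ⊆? neutral C D) ⟧) * inv (ιℕ (suc (width C D) ∸ k))) ⟫
    interaction-⟪⟫ S T k S∩T≡⊥ ∣S∪T∣≡k = trans (interaction-mobius n v S T) (⟪⟫-cong λ C D _ →
      trans (interaction-unanimity n C D S T S∩T≡⊥)
            (⟦⟧*⟦⟧*-cong (does (S ⊆? C)) _ (λ S⊆C T⊆E → cong (λ x → inv (ιℕ x)) (begin
              suc ∣ forcedSet C D S T ∣                                   ≡⟨ sym (ℕ.m+n∸n≡m _ k) ⟩
              suc ∣ forcedSet C D S T ∣ +ℕ k ∸ k                         ≡⟨ cong (λ j → suc ∣ forcedSet C D S T ∣ +ℕ j ∸ k) (sym ∣S∪T∣≡k) ⟩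
              suc (∣ forcedSet C D S T ∣ +ℕ ∣ S ∪ T ∣) ∸ k               ≡⟨ cong (λ j → suc j ∸ k) (∣forcedSet∣+∣S∪T∣ C D S T S⊆C T⊆E) ⟩
              suc (width C D) ∸ k                                       ∎))))

    interaction-⁅⁆-∅ : ∀ i → interaction v ⁅ i ⁆ ⊥ ≡ ⟪ (λ C D → ⟦ does (⁅ i ⁆ ⊆? C) ⟧ * inv (ιℕ (width C D))) ⟫
    interaction-⁅⁆-∅ i =
      trans (interaction-⟪⟫ ⁅ i ⁆ ⊥ 1 (∩-zeroʳ ⁅ i ⁆) (trans (cong ∣_∣ (∪-identityʳ ⁅ i ⁆)) (∣⁅x⁆∣≡1 i)))
            (⟪⟫-cong λ C D _ → cong (_* inv (ιℕ (width C D)))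
              (trans (cong (λ b → ⟦ does (⁅ i ⁆ ⊆? C) ⟧ * ⟦ b ⟧) (⊥⊆? neutral C D)) (*-identityʳ _)))

    interaction-∅-⁅⁆ : ∀ i → interaction v ⊥ ⁅ i ⁆ ≡ ⟪ (λ C D → ⟦ does (⁅ i ⁆ ⊆? neutral C D) ⟧ * inv (ιℕ (width C D))) ⟫
    interaction-∅-⁅⁆ i =
      trans (interaction-⟪⟫ ⊥ ⁅ i ⁆ 1 (∩-zeroˡ ⁅ i ⁆) (trans (cong ∣_∣ (∪-identityˡ ⁅ i ⁆)) (∣⁅x⁆∣≡1 i)))
            (⟪⟫-cong λ C D _ → cong (_* inv (ιℕ (width C D)))
              (trans (cong (λ b → ⟦ b ⟧ * ⟦ does (⁅ i ⁆ ⊆? neutral C D) ⟧) (⊥⊆? C)) (*-identityˡ _)))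

    interaction-∅-∅ : interaction v ⊥ ⊥ ≡ ⟪ (λ C D → inv (ιℕ (suc (width C D)))) ⟫
    interaction-∅-∅ =
      trans (interaction-⟪⟫ ⊥ ⊥ 0 (∩-zeroʳ ⊥) (trans (cong ∣_∣ (∪-identityˡ (⊥ {n}))) (∣⊥∣≡0 n)))
            (⟪⟫-cong λ C D _ → trans (cong (λ x → x * inv (ιℕ (suc (width C D))))
              (trans (cong₂ (λ a b → ⟦ a ⟧ * ⟦ b ⟧) (⊥⊆? C) (⊥⊆? neutral C D)) (*-identityʳ 1#))) (*-identityˡ _))

    interaction-⁅⁆-⁅⁆ : ∀ i j → (if does (i Fin.≟ j) then 0# else interaction v ⁅ i ⁆ ⁅ j ⁆)
      ≡ ⟪ (λ C D → (⟦ does (⁅ i ⁆ ⊆? C) ⟧ * ⟦ does (⁅ j ⁆ ⊆? neutral C D) ⟧) * inv (ιℕ (width C D ∸ 1))) ⟫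
    interaction-⁅⁆-⁅⁆ i j with i Fin.≟ j
    ... | yes refl = sym (trans (⟪⟫-cong (λ C D _ → trans (cong (_* inv (ιℕ (width C D ∸ 1))) (⟦⁅⁆⊆?C⟧*⟦⁅⁆⊆?E⟧≡0 i C D)) (zeroˡ _)))
                                (trans (∑²-cong n (λ C D → zeroʳ _)) (∑²-0 n)))
    ... | no  i≢j  = interaction-⟪⟫ ⁅ i ⁆ ⁅ j ⁆ 2 (⁅⁆∩⁅⁆≡⊥ i j i≢j)
                       (trans (∣∪∣≡+ ⁅ i ⁆ ⁅ j ⁆ (⁅⁆∩⁅⁆≡⊥ i j i≢j)) (cong₂ _+ℕ_ (∣⁅x⁆∣≡1 i) (∣⁅x⁆∣≡1 j)))

    interaction-pair : ∀ S → ⟦ does (∣ S ∣ ≟ 2) ⟧ * (interaction v S ⊥ + interaction v ⊥ S)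
      ≡ ⟪ (λ C D → ⟦ does (∣ S ∣ ≟ 2) ⟧ * ((⟦ does (S ⊆? C) ⟧ + ⟦ does (S ⊆? neutral C D) ⟧) * inv (ιℕ (width C D ∸ 1)))) ⟫
    interaction-pair S = trans (⟦⟧*-cong (does (∣ S ∣ ≟ 2)) (λ ∣S∣≟2 → sum≡ (does⇒ (∣ S ∣ ≟ 2) ∣S∣≟2))) (sym (⟪⟫-*ˡ _ _))
      where
        w = λ C D → inv (ιℕ (width C D ∸ 1))
        sum≡ : ∣ S ∣ ≡ 2 → interaction v S ⊥ + interaction v ⊥ S ≡ ⟪ (λ C D → (⟦ does (S ⊆? C) ⟧ + ⟦ does (S ⊆? neutral C D) ⟧) * w C D) ⟫
        sum≡ ∣S∣≡2 = begin
          interaction v S ⊥ + interaction v ⊥ S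
            ≡⟨ cong₂ _+_ (interaction-⟪⟫ S ⊥ 2 (∩-zeroʳ S) (trans (cong ∣_∣ (∪-identityʳ S)) ∣S∣≡2))
                         (interaction-⟪⟫ ⊥ S 2 (∩-zeroˡ S) (trans (cong ∣_∣ (∪-identityˡ S)) ∣S∣≡2)) ⟩
          ⟪ (λ C D → (⟦ does (S ⊆? C) ⟧ * ⟦ does (⊥ ⊆? neutral C D) ⟧) * w C D) ⟫
            + ⟪ (λ C D → (⟦ does (⊥ ⊆? C) ⟧ * ⟦ does (S ⊆? neutral C D) ⟧) * w C D) ⟫
            ≡⟨ sym (⟪⟫-+ _ _) ⟩
          ⟪ (λ C D → (⟦ does (S ⊆? C) ⟧ * ⟦ does (⊥ ⊆? neutral C D) ⟧) * w C D + (⟦ does (⊥ ⊆? C) ⟧ * ⟦ does (S ⊆? neutral C D) ⟧) * w C D) ⟫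
            ≡⟨ ⟪⟫-cong (λ C D _ → trans (cong₂ (λ a b → (⟦ does (S ⊆? C) ⟧ * ⟦ a ⟧) * w C D + (⟦ b ⟧ * ⟦ does (S ⊆? neutral C D) ⟧) * w C D)
                                                 (⊥⊆? neutral C D) (⊥⊆? C))
                                        (solve 3 (λ a b x → (a :* con (ℤ.+ 1)) :* x :+ (con (ℤ.+ 1) :* b) :* x := (a :+ b) :* x) refl _ _ _)) ⟩
          ⟪ (λ C D → (⟦ does (S ⊆? C) ⟧ + ⟦ does (S ⊆? neutral C D) ⟧) * w C D) ⟫ ∎

  ½ ⅓ ⅙ : Carrier
  ½ = inv (ιℕ 2)
  ⅓ = inv (ιℕ 3)
  ⅙ = inv (ιℕ 6)

  2*½≡1 : ιℕ 2 * ½ ≡ 1#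
  2*½≡1 = *-inv _ (ιℕ-suc≢0 1)

  ⅙≡½*⅓ : ⅙ ≡ ½ * ⅓
  ⅙≡½*⅓ = trans (cong inv (×1-homo-* 2 3)) (inv-* _ _ (ιℕ-suc≢0 1) (ιℕ-suc≢0 2))

  ⅓≡½-⅙ : ⅓ ≡ - ⅙ + ½
  ⅓≡½-⅙ = begin
    ⅓                           ≡⟨ sym (trans (cong (⅓ *_) 2*½≡1) (*-identityʳ ⅓)) ⟩
    ⅓ * (ιℕ 2 * ½)              ≡⟨ solve 2 (λ h t → t :* (con (ℤ.+ 2) :* h) := :- (h :* t) :+ h :* (con (ℤ.+ 3) :* t)) refl ½ ⅓ ⟩
    - (½ * ⅓) + ½ * (ιℕ 3 * ⅓)  ≡⟨ cong₂ (λ x y → - x + ½ * y) (sym ⅙≡½*⅓) (*-inv _ (ιℕ-suc≢0 2)) ⟩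
    - ⅙ + ½ * 1#                ≡⟨ cong (- ⅙ +_) (*-identityʳ ½) ⟩
    - ⅙ + ½                     ∎

  -- Since inv 0# = 0#, y · y⁻¹ = 1 − [y = 0].
  ιℕ*inv : ∀ y → ιℕ y * inv (ιℕ y) ≡ 1# + - ⟦ y ≡ᵇ 0 ⟧
  ιℕ*inv zero    = trans (zeroˡ _) (sym (-‿inverseʳ 1#))
  ιℕ*inv (suc y) = trans (*-inv _ (ιℕ-suc≢0 y)) (solve 1 (λ u → u := u :+ :- con (ℤ.+ 0)) refl 1#)

  -- Here y = |C| + |E| ≤ 2.  When y = 1 the junk value (y ∸ 1)⁻¹ = inv 0# = 0# is harmless,
  -- since it is multiplied by |C| |E| = 0 or by a vanishing binomial coefficient.
  pointwise-ii : ∀ {y} c e → y ≡ c +ℕ e → y ≤ℕ 2 →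
    ιℕ e * inv (ιℕ y) ≡ ½ * ((ιℕ c * ιℕ e) * inv (ιℕ (y ∸ 1))) + (⟦ c ≡ᵇ 0 ⟧ + - ⟦ y ≡ᵇ 0 ⟧)
  pointwise-ii 0 0 refl _ = solve 2 (λ h z → con (ℤ.+ 0) :* z := h :* ((con (ℤ.+ 0) :* con (ℤ.+ 0)) :* z) :+ (con (ℤ.+ 1) :+ :- con (ℤ.+ 1))) refl ½ (inv 0#)
  pointwise-ii 1 0 refl _ = solve 3 (λ h z o → con (ℤ.+ 0) :* o := h :* ((con (ℤ.+ 1) :* con (ℤ.+ 0)) :* z) :+ (con (ℤ.+ 0) :+ :- con (ℤ.+ 0))) refl ½ (inv 0#) (inv 1#)
  pointwise-ii 0 1 refl _ rewrite inv-1 = solve 2 (λ h z → con (ℤ.+ 1) :* con (ℤ.+ 1) := h :* ((con (ℤ.+ 0) :* con (ℤ.+ 1)) :* z) :+ (con (ℤ.+ 1) :+ :- con (ℤ.+ 0))) refl ½ (inv 0#)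
  pointwise-ii 2 0 refl _ = solve 2 (λ h o → con (ℤ.+ 0) :* h := h :* ((con (ℤ.+ 2) :* con (ℤ.+ 0)) :* o) :+ (con (ℤ.+ 0) :+ :- con (ℤ.+ 0))) refl ½ (inv 1#)
  pointwise-ii 1 1 refl _ rewrite inv-1 = solve 1 (λ h → con (ℤ.+ 1) :* h := h :* ((con (ℤ.+ 1) :* con (ℤ.+ 1)) :* con (ℤ.+ 1)) :+ (con (ℤ.+ 0) :+ :- con (ℤ.+ 0))) refl ½
  pointwise-ii 0 2 refl _ = trans 2*½≡1 (solve 2 (λ h o → con (ℤ.+ 1) := h :* ((con (ℤ.+ 0) :* con (ℤ.+ 2)) :* o) :+ (con (ℤ.+ 1) :+ :- con (ℤ.+ 0))) refl ½ (inv 1#))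
  pointwise-ii 0 (suc (suc (suc e))) refl (s≤s (s≤s ()))
  pointwise-ii 1 (suc (suc e))       refl (s≤s (s≤s ()))
  pointwise-ii 2 (suc e)             refl (s≤s (s≤s ()))
  pointwise-ii (suc (suc (suc c))) e refl (s≤s (s≤s ()))

  pointwise-iii : ∀ {y} c e → y ≡ c +ℕ e → y ≤ℕ 2 →
    inv (ιℕ (suc y))
    ≡ - (⅙ * ((ιℕ c * ιℕ e) * inv (ιℕ (y ∸ 1)) + (ιℕ (c choose 2) + ιℕ (e choose 2)) * inv (ιℕ (y ∸ 1))))
      + ½ * (1# + ⟦ y ≡ᵇ 0 ⟧)
  pointwise-iii 0 0 refl _ rewrite inv-1 =
    trans (sym 2*½≡1) (solve 3 (λ h s z → con (ℤ.+ 2) :* h := :- (s :* ((con (ℤ.+ 0) :* con (ℤ.+ 0)) :* z :+ (con (ℤ.+ 0) :+ con (ℤ.+ 0)) :* z)) :+ h :* (con (ℤ.+ 1) :+ con (ℤ.+ 1))) refl ½ ⅙ (inv 0#))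
  pointwise-iii 1 0 refl _ = solve 3 (λ h s z → h := :- (s :* ((con (ℤ.+ 1) :* con (ℤ.+ 0)) :* z :+ (con (ℤ.+ 0) :+ con (ℤ.+ 0)) :* z)) :+ h :* (con (ℤ.+ 1) :+ con (ℤ.+ 0))) refl ½ ⅙ (inv 0#)
  pointwise-iii 0 1 refl _ = solve 3 (λ h s z → h := :- (s :* ((con (ℤ.+ 0) :* con (ℤ.+ 1)) :* z :+ (con (ℤ.+ 0) :+ con (ℤ.+ 0)) :* z)) :+ h :* (con (ℤ.+ 1) :+ con (ℤ.+ 0))) refl ½ ⅙ (inv 0#)
  pointwise-iii 2 0 refl _ rewrite inv-1 = trans ⅓≡½-⅙ (solve 2 (λ h s → :- s :+ h := :- (s :* ((con (ℤ.+ 2) :* con (ℤ.+ 0)) :* con (ℤ.+ 1) :+ (con (ℤ.+ 1) :+ con (ℤ.+ 0)) :* con (ℤ.+ 1))) :+ h :* (con (ℤ.+ 1) :+ con (ℤ.+ 0))) refl ½ ⅙)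
  pointwise-iii 1 1 refl _ rewrite inv-1 = trans ⅓≡½-⅙ (solve 2 (λ h s → :- s :+ h := :- (s :* ((con (ℤ.+ 1) :* con (ℤ.+ 1)) :* con (ℤ.+ 1) :+ (con (ℤ.+ 0) :+ con (ℤ.+ 0)) :* con (ℤ.+ 1))) :+ h :* (con (ℤ.+ 1) :+ con (ℤ.+ 0))) refl ½ ⅙)
  pointwise-iii 0 2 refl _ rewrite inv-1 = trans ⅓≡½-⅙ (solve 2 (λ h s → :- s :+ h := :- (s :* ((con (ℤ.+ 0) :* con (ℤ.+ 2)) :* con (ℤ.+ 1) :+ (con (ℤ.+ 0) :+ con (ℤ.+ 1)) :* con (ℤ.+ 1))) :+ h :* (con (ℤ.+ 1) :+ con (ℤ.+ 0))) refl ½ ⅙)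
  pointwise-iii 0 (suc (suc (suc e))) refl (s≤s (s≤s ()))
  pointwise-iii 1 (suc (suc e))       refl (s≤s (s≤s ()))
  pointwise-iii 2 (suc e)             refl (s≤s (s≤s ()))
  pointwise-iii (suc (suc (suc c))) e refl (s≤s (s≤s ()))

  module _ (n : ℕ) (v : Subset n → Subset n → Carrier) where
    open Bicap F n using (interaction; sumN; sumNeq; sumPairs; sumSub; fromℕ; IsNormalized; IsBiCapacity; Is2Additive)

    open MobiusExpansion n v

    private
      I = interaction v
      E = neutral {n}
      w = width

    sum-⟦⁅⁆⊆?⟧* : ∀ X x → sum (λ i → ⟦ does (⁅ i ⁆ ⊆? X) ⟧ * x) ≡ ιℕ ∣ X ∣ * x
    sum-⟦⁅⁆⊆?⟧* X x = trans (sym (*-distribʳ-sum x (λ i → ⟦ does (⁅ i ⁆ ⊆? X) ⟧))) (cong (_* x) (sum-⟦⁅⁆⊆?⟧ n X))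

    identity-i : IsNormalized v → sumN (λ i → I ⁅ i ⁆ ⊥ + I ⊥ ⁅ i ⁆) ≡ fromℕ 2
    identity-i (v-N-∅≡1 , v-∅-N≡-1) = begin
      sumN (λ i → I ⁅ i ⁆ ⊥ + I ⊥ ⁅ i ⁆)
        ≡⟨ sumN≡sum n _ ⟩
      sum (λ i → I ⁅ i ⁆ ⊥ + I ⊥ ⁅ i ⁆)
        ≡⟨ sum-cong-≗ {n} (λ i → trans (cong₂ _+_ (interaction-⁅⁆-∅ i) (interaction-∅-⁅⁆ i)) (sym (⟪⟫-+ _ _))) ⟩
      sum (λ i → ⟪ (λ C D → ⟦ does (⁅ i ⁆ ⊆? C) ⟧ * inv (ιℕ (w C D)) + ⟦ does (⁅ i ⁆ ⊆? E C D) ⟧ * inv (ιℕ (w C D))) ⟫)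
        ≡⟨ sum-⟪⟫ _ ⟩
      ⟪ (λ C D → sum (λ i → ⟦ does (⁅ i ⁆ ⊆? C) ⟧ * inv (ιℕ (w C D)) + ⟦ does (⁅ i ⁆ ⊆? E C D) ⟧ * inv (ιℕ (w C D)))) ⟫
        ≡⟨ ⟪⟫-cong (λ C D _ → begin
             sum (λ i → ⟦ does (⁅ i ⁆ ⊆? C) ⟧ * inv (ιℕ (w C D)) + ⟦ does (⁅ i ⁆ ⊆? E C D) ⟧ * inv (ιℕ (w C D)))
               ≡⟨ trans (sum-distrib-+ (λ i → ⟦ does (⁅ i ⁆ ⊆? C) ⟧ * inv (ιℕ (w C D))) (λ i → ⟦ does (⁅ i ⁆ ⊆? E C D) ⟧ * inv (ιℕ (w C D)))) (cong₂ _+_ (sum-⟦⁅⁆⊆?⟧* C _) (sum-⟦⁅⁆⊆?⟧* (E C D) _)) ⟩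
             ιℕ ∣ C ∣ * inv (ιℕ (w C D)) + ιℕ ∣ E C D ∣ * inv (ιℕ (w C D))
               ≡⟨ trans (sym (distribʳ _ _ _)) (cong (_* inv (ιℕ (w C D))) (sym (trans (cong ιℕ (∣C∪E∣≡∣C∣+∣E∣ C D)) (×-homo-+ 1# ∣ C ∣ ∣ E C D ∣)))) ⟩
             ιℕ (w C D) * inv (ιℕ (w C D))
               ≡⟨ ιℕ*inv (w C D) ⟩
             1# + - ⟦ w C D ≡ᵇ 0 ⟧ ∎) ⟩
      ⟪ (λ C D → 1# + - ⟦ w C D ≡ᵇ 0 ⟧) ⟫
        ≡⟨ ⟪⟫-- _ _ ⟩
      ⟪ (λ _ _ → 1#) ⟫ + - ⟪ (λ C D → ⟦ w C D ≡ᵇ 0 ⟧) ⟫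
        ≡⟨ sym (cong₂ (λ x y → x + - y) (v-N-∅) (v-∅-N)) ⟩
      v ⊤ ⊥ + - v ⊥ ⊤
        ≡⟨ cong₂ (λ x y → x + - y) v-N-∅≡1 v-∅-N≡-1 ⟩
      1# + - (- 1#)
        ≡⟨ solve 0 (con (ℤ.+ 1) :+ :- (:- con (ℤ.+ 1)) := con (ℤ.+ 1) :+ (con (ℤ.+ 1) :+ con (ℤ.+ 0))) refl ⟩
      fromℕ 2 ∎

    sumNeq-⟪⟫ : sumNeq (λ i j → I ⁅ i ⁆ ⁅ j ⁆) ≡ ⟪ (λ C D → (ιℕ ∣ C ∣ * ιℕ ∣ E C D ∣) * inv (ιℕ (w C D ∸ 1))) ⟫
    sumNeq-⟪⟫ = begin
      sumN (λ i → sumN (λ j → if does (i Fin.≟ j) then 0# else I ⁅ i ⁆ ⁅ j ⁆))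
        ≡⟨ trans (sumN≡sum n _) (sum-cong-≗ {n} (λ i → sumN≡sum n _)) ⟩
      sum (λ i → sum (λ j → if does (i Fin.≟ j) then 0# else I ⁅ i ⁆ ⁅ j ⁆))
        ≡⟨ sum-cong-≗ {n} (λ i → trans (sum-cong-≗ {n} (interaction-⁅⁆-⁅⁆ i)) (sum-⟪⟫ (t i))) ⟩
      sum (λ i → ⟪ (λ C D → sum (λ j → t i j C D)) ⟫)
        ≡⟨ sum-⟪⟫ _ ⟩
      ⟪ (λ C D → sum (λ i → sum (λ j → t i j C D))) ⟫
        ≡⟨ ⟪⟫-cong (λ C D _ → count-pairs C D) ⟩
      ⟪ (λ C D → (ιℕ ∣ C ∣ * ιℕ ∣ E C D ∣) * inv (ιℕ (w C D ∸ 1))) ⟫ ∎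
      where
        t = λ (i j : Fin n) (C D : Subset n) → (⟦ does (⁅ i ⁆ ⊆? C) ⟧ * ⟦ does (⁅ j ⁆ ⊆? E C D) ⟧) * inv (ιℕ (w C D ∸ 1))
        count-pairs : ∀ C D → sum (λ i → sum (λ j → t i j C D)) ≡ (ιℕ ∣ C ∣ * ιℕ ∣ E C D ∣) * inv (ιℕ (w C D ∸ 1))
        count-pairs C D = begin
          sum (λ i → sum (λ j → (c i * e j) * x))
            ≡⟨ sum-cong-≗ {n} (λ i → trans (sum-cong-≗ {n} (λ j → solve 3 (λ c e x → (c :* e) :* x := e :* (c :* x)) refl (c i) (e j) x))
                                       (sum-⟦⁅⁆⊆?⟧* (E C D) (c i * x))) ⟩
          sum (λ i → ιℕ ∣ E C D ∣ * (c i * x))  ≡⟨ sym (*-distribˡ-sum (ιℕ ∣ E C D ∣) (λ i → c i * x)) ⟩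
          ιℕ ∣ E C D ∣ * sum (λ i → c i * x)    ≡⟨ cong (ιℕ ∣ E C D ∣ *_) (sum-⟦⁅⁆⊆?⟧* C x) ⟩
          ιℕ ∣ E C D ∣ * (ιℕ ∣ C ∣ * x)         ≡⟨ solve 3 (λ e c x → e :* (c :* x) := (c :* e) :* x) refl _ _ _ ⟩
          (ιℕ ∣ C ∣ * ιℕ ∣ E C D ∣) * x         ∎
          where
            c = λ (i : Fin n) → ⟦ does (⁅ i ⁆ ⊆? C) ⟧
            e = λ (j : Fin n) → ⟦ does (⁅ j ⁆ ⊆? E C D) ⟧
            x = inv (ιℕ (w C D ∸ 1))

    identity-ii : Is2Additive v → IsBiCapacity v → IsNormalized v →
      sumN (λ i → I ⊥ ⁅ i ⁆) ≡ inv (fromℕ 2) * sumNeq (λ i j → I ⁅ i ⁆ ⁅ j ⁆) + 1#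
    identity-ii 2-additive (_ , v-∅-∅≡0) (_ , v-∅-N≡-1) = begin
      sumN (λ i → I ⊥ ⁅ i ⁆)
        ≡⟨ trans (sumN≡sum n _) (trans (sum-cong-≗ {n} (interaction-∅-⁅⁆)) (sum-⟪⟫ _)) ⟩
      ⟪ (λ C D → sum (λ i → ⟦ does (⁅ i ⁆ ⊆? E C D) ⟧ * inv (ιℕ (w C D)))) ⟫
        ≡⟨ ⟪⟫-cong (λ C D _ → sum-⟦⁅⁆⊆?⟧* (E C D) _) ⟩
      ⟪ (λ C D → ιℕ ∣ E C D ∣ * inv (ιℕ (w C D))) ⟫
        ≡⟨ ⟪⟫-cong-2additive 2-additive (λ C D _ narrow → pointwise-ii ∣ C ∣ ∣ E C D ∣ (∣C∪E∣≡∣C∣+∣E∣ C D) narrow) ⟩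
      ⟪ (λ C D → ½ * pairs C D + (⟦ ∣ C ∣ ≡ᵇ 0 ⟧ + - ⟦ w C D ≡ᵇ 0 ⟧)) ⟫
        ≡⟨ trans (⟪⟫-+ _ _) (cong₂ _+_ (⟪⟫-*ˡ ½ pairs) (⟪⟫-- _ _)) ⟩
      ½ * ⟪ pairs ⟫ + (⟪ (λ C D → ⟦ ∣ C ∣ ≡ᵇ 0 ⟧) ⟫ + - ⟪ (λ C D → ⟦ w C D ≡ᵇ 0 ⟧) ⟫)
        ≡⟨ cong₂ (λ x y → ½ * x + y) (sym sumNeq-⟪⟫) (sym (cong₂ (λ x y → x + - y) v-∅-∅ v-∅-N)) ⟩
      ½ * sumNeq (λ i j → I ⁅ i ⁆ ⁅ j ⁆) + (v ⊥ ⊥ + - v ⊥ ⊤)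
        ≡⟨ cong₂ (λ x y → inv x * sumNeq (λ i j → I ⁅ i ⁆ ⁅ j ⁆) + y) (sym (fromℕ≡ιℕ n 2))
                 (trans (cong₂ (λ x y → x + - y) v-∅-∅≡0 v-∅-N≡-1) (solve 0 (con (ℤ.+ 0) :+ :- (:- con (ℤ.+ 1)) := con (ℤ.+ 1)) refl)) ⟩
      inv (fromℕ 2) * sumNeq (λ i j → I ⁅ i ⁆ ⁅ j ⁆) + 1# ∎
      where pairs = λ C D → (ιℕ ∣ C ∣ * ιℕ ∣ E C D ∣) * inv (ιℕ (w C D ∸ 1))

    sumPairs-⟪⟫ : sumPairs (λ S → I S ⊥ + I ⊥ S)
      ≡ ⟪ (λ C D → (ιℕ (∣ C ∣ choose 2) + ιℕ (∣ E C D ∣ choose 2)) * inv (ιℕ (w C D ∸ 1))) ⟫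
    sumPairs-⟪⟫ = begin
      sumPairs (λ S → I S ⊥ + I ⊥ S)                                  ≡⟨ sumSub≡∑ n _ _ ⟩
      ∑ n (λ S → ⟦ does (∣ S ∣ ≟ 2) ⟧ * (I S ⊥ + I ⊥ S))              ≡⟨ trans (∑-cong n interaction-pair) (∑-⟪⟫ _) ⟩
      ⟪ (λ C D → ∑ n (λ S → ⟦ does (∣ S ∣ ≟ 2) ⟧ * ((c S C + e C D S) * x C D))) ⟫ ≡⟨ ⟪⟫-cong (λ C D _ → count-pairs C D) ⟩
      ⟪ (λ C D → (ιℕ (∣ C ∣ choose 2) + ιℕ (∣ E C D ∣ choose 2)) * x C D) ⟫ ∎
      where
        c = λ S C → ⟦ does (S ⊆? C) ⟧
        e = λ C D S → ⟦ does (S ⊆? E C D) ⟧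
        x = λ C D → inv (ιℕ (w C D ∸ 1))
        count-pairs : ∀ C D → ∑ n (λ S → ⟦ does (∣ S ∣ ≟ 2) ⟧ * ((c S C + e C D S) * x C D))
                              ≡ (ιℕ (∣ C ∣ choose 2) + ιℕ (∣ E C D ∣ choose 2)) * x C D
        count-pairs C D = begin
          ∑ n (λ S → ⟦ does (∣ S ∣ ≟ 2) ⟧ * ((c S C + e C D S) * x C D))
            ≡⟨ ∑-cong n (λ S → solve 4 (λ b p q x → b :* ((p :+ q) :* x) := (b :* p) :* x :+ (b :* q) :* x) refl _ _ _ _) ⟩
          ∑ n (λ S → (⟦ does (∣ S ∣ ≟ 2) ⟧ * c S C) * x C D + (⟦ does (∣ S ∣ ≟ 2) ⟧ * e C D S) * x C D)
            ≡⟨ trans (∑-+ n _ _) (cong₂ _+_ (∑-*ʳ n _ _) (∑-*ʳ n _ _)) ⟩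
          ∑ n (λ S → ⟦ does (∣ S ∣ ≟ 2) ⟧ * c S C) * x C D + ∑ n (λ S → ⟦ does (∣ S ∣ ≟ 2) ⟧ * e C D S) * x C D
            ≡⟨ cong₂ (λ a b → a * x C D + b * x C D) (∑-subsets-of-size n 2 C) (∑-subsets-of-size n 2 (E C D)) ⟩
          ιℕ (∣ C ∣ choose 2) * x C D + ιℕ (∣ E C D ∣ choose 2) * x C D
            ≡⟨ sym (distribʳ _ _ _) ⟩
          (ιℕ (∣ C ∣ choose 2) + ιℕ (∣ E C D ∣ choose 2)) * x C D ∎

    identity-iii : Is2Additive v → IsNormalized v →
      I ⊥ ⊥ ≡ - (inv (fromℕ 6) * (sumNeq (λ i j → I ⁅ i ⁆ ⁅ j ⁆) + sumPairs (λ S → I S ⊥ + I ⊥ S)))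
    identity-iii 2-additive (v-N-∅≡1 , v-∅-N≡-1) = begin
      I ⊥ ⊥
        ≡⟨ interaction-∅-∅ ⟩
      ⟪ (λ C D → inv (ιℕ (suc (w C D)))) ⟫
        ≡⟨ ⟪⟫-cong-2additive 2-additive (λ C D _ narrow → pointwise-iii ∣ C ∣ ∣ E C D ∣ (∣C∪E∣≡∣C∣+∣E∣ C D) narrow) ⟩
      ⟪ (λ C D → - (⅙ * (pairs C D + within C D)) + ½ * (1# + ⟦ w C D ≡ᵇ 0 ⟧)) ⟫
        ≡⟨ ⟪⟫-cong (λ C D _ → solve 5 (λ s p q h z → :- (s :* (p :+ q)) :+ h :* (con (ℤ.+ 1) :+ z)
                                                := (:- s) :* p :+ ((:- s) :* q :+ (h :* con (ℤ.+ 1) :+ h :* z))) refl _ _ _ _ _) ⟩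
      ⟪ (λ C D → (- ⅙) * pairs C D + ((- ⅙) * within C D + (½ * 1# + ½ * ⟦ w C D ≡ᵇ 0 ⟧))) ⟫
        ≡⟨ trans (⟪⟫-+ _ _) (cong₂ _+_ (⟪⟫-*ˡ _ _) (trans (⟪⟫-+ _ _) (cong₂ _+_ (⟪⟫-*ˡ _ _)
             (trans (⟪⟫-+ _ _) (cong₂ _+_ (⟪⟫-*ˡ ½ (λ _ _ → 1#)) (⟪⟫-*ˡ _ _)))))) ⟩
      (- ⅙) * ⟪ pairs ⟫ + ((- ⅙) * ⟪ within ⟫ + normalization)
        ≡⟨ cong₂ (λ x y → (- ⅙) * x + ((- ⅙) * y + normalization)) (sym sumNeq-⟪⟫) (sym sumPairs-⟪⟫) ⟩
      (- ⅙) * Σneq + ((- ⅙) * Σpairs + normalization)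
        ≡⟨ cong₂ (λ x y → (- ⅙) * Σneq + ((- ⅙) * Σpairs + (½ * x + ½ * y)))
                 (trans (sym v-N-∅) v-N-∅≡1) (trans (sym v-∅-N) v-∅-N≡-1) ⟩
      (- ⅙) * Σneq + ((- ⅙) * Σpairs + (½ * 1# + ½ * (- 1#)))
        ≡⟨ solve 4 (λ s a b h → (:- s) :* a :+ ((:- s) :* b :+ (h :* con (ℤ.+ 1) :+ h :* (:- con (ℤ.+ 1)))) := :- (s :* (a :+ b))) refl ⅙ Σneq Σpairs ½ ⟩
      - (⅙ * (Σneq + Σpairs))
        ≡⟨ cong (λ t → - (inv t * (Σneq + Σpairs))) (sym (fromℕ≡ιℕ n 6)) ⟩
      - (inv (fromℕ 6) * (Σneq + Σpairs)) ∎
      where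
        pairs = λ C D → (ιℕ ∣ C ∣ * ιℕ ∣ E C D ∣) * inv (ιℕ (w C D ∸ 1))
        within = λ C D → (ιℕ (∣ C ∣ choose 2) + ιℕ (∣ E C D ∣ choose 2)) * inv (ιℕ (w C D ∸ 1))
        Σneq = sumNeq (λ i j → I ⁅ i ⁆ ⁅ j ⁆)
        Σpairs = sumPairs (λ S → I S ⊥ + I ⊥ S)
        normalization = ½ * ⟪ (λ _ _ → 1#) ⟫ + ½ * ⟪ (λ C D → ⟦ w C D ≡ᵇ 0 ⟧) ⟫

proposition5 : (F : OrderedField) (n : ℕ) →
  let open OrderedField F
      open Bicap F n
  in (v : BiFun) → IsBiCapacity v → IsNormalized v → Is2Additive v →
     let I = interaction v
     in (sumN (λ i → I ⁅ i ⁆ ⊥ + I ⊥ ⁅ i ⁆) ≡ fromℕ 2)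
        × (sumN (λ i → I ⊥ ⁅ i ⁆) ≡ inv (fromℕ 2) * sumNeq (λ i j → I ⁅ i ⁆ ⁅ j ⁆) + 1#)
        × (I ⊥ ⊥ ≡ - (inv (fromℕ 6) * (sumNeq (λ i j → I ⁅ i ⁆ ⁅ j ⁆) + sumPairs (λ S → I S ⊥ + I ⊥ S))))
proposition5 F n v capacity normalized 2-additive =
  identity-i F n v normalized , identity-ii F n v 2-additive capacity normalized , identity-iii F n v 2-additive normalized
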